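{- Let $n\ge1$ and let $X\in\{\mathfrak{G}^{\mathrm{II}}_{2n},\mathfrak{G}^{\mathrm{III}}_{2n},\mathfrak{G}^{\mathrm{IV}}_{2n}\}$. For every region $R$ of $\mathcal{K}_{2n}$ there is exactly one permutation in $X$ compatible with $R$, and the resulting map $\mathcal{R}(\mathcal{K}_{2n})\to X$ (denoted $\Lambda^{\mathrm{II}},\Lambda^{\mathrm{III}},\Lambda^{\mathrm{IV}}$ respectively) is a bijection.
   Context: $\mathcal{K}_{2n}$ is the arrangement in $\mathbb{R}^{2n+1}$ of the hyperplanes $x_{2i-1}-x_{2j}=0$, $1\le i\le j\le n$; $\mathcal{R}(\mathcal{K}_{2n})$ is its set of regions (connected components of the complement). A permutation $\pi$ of $[2n]$ is compatible with a region $R$ if for every pair $(i,j)$ with $i<j$, $i$ odd, $j$ even, and every $\mathbf{x}\in R$: $\pi^{ -1}(i)<\pi^{ -1}(j)$ iff $x_i<x_j$. Parity patterns for a permutation $\sigma=\sigma_1\cdots\sigma_{2n}$ at adjacent positions $(\sigma_i,\sigma_{i+1})$: $\mathrm{eE}$ = ascent with both even; $\mathrm{eO}$ = ascent with $\sigma_i$ even, $\sigma_{i+1}$ odd; $\mathrm{oO}$ = ascent with both odd; $\mathrm{Ee}$ = descent with both even; $\mathrm{Oe}$ = descent with $\sigma_i$ odd, $\sigma_{i+1}$ even; $\mathrm{Oo}$ = descent with both odd. $\mathfrak{G}^{\mathrm{II}}_{2n}$: permutations $\sigma$ of $[2n]$ containing no $\mathrm{Ee}$, $\mathrm{eO}$,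 $\mathrm{oO}$, and such that whenever $(\sigma_m,\sigma_{m+1})$ is an $\mathrm{Oe}$ pattern, $\sigma_1,\dots,\sigma_m$ are all odd and $\sigma_1>\sigma_2>\cdots>\sigma_m$. $\mathfrak{G}^{\mathrm{III}}_{2n}$: permutations of $[2n]$ containing no $\mathrm{Oo}$ and no $\mathrm{eE}$, and no $\mathrm{eO}_d$ for any $d\ge0$, where a pair $(\sigma_i,\sigma_j)$ is an $\mathrm{eO}_d$ if $j=i+d+1$, $\sigma_i$ is even, $\sigma_l$ is odd for all $i<l\le j$, and $\sigma_i<\sigma_j$. $\mathfrak{G}^{\mathrm{IV}}_{2n}$: permutations of $[2n]$ containing no $\mathrm{eO}$, and no $\mathrm{Oo}_d$ or $\mathrm{Ee}_d$ for any $d\ge0$, where: $(\sigma_i,\sigma_j)$ is an $\mathrm{Oo}_d$ if $\sigma_i,\sigma_j$ are odd, the factor $\alpha=\sigma_{i+1}\cdots\sigma_{j-1}$ has length $d$ and consists only of even letters, and $\sigma_i>\sigma_j$ when $d=0$, $\sigma_i>\max(\alpha)>\sigma_j$ when $d>0$; $(\sigma_i,\sigma_j)$ is an $\mathrm{Ee}_d$ if $\sigma_i,\sigma_j$ are even, $\alpha=\sigma_{i+1}\cdots\sigma_{j-1}$ has length $d$ and consists only of odd letters, and $\sigma_i>\sigma_j$ when $d=0$, $\sigma_i>\min(\alpha)>\sigma_j$ when $d>0$.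
   Formalization: Points have rational coordinates instead of real ones, so the regions of $\mathcal{K}_{2n}$ consist of rational points of the complement. -}

module Defs where

open import Data.Nat using (ℕ; zero; suc; _+_; _*_; _∸_; _≤_; _<_; _>_; _⊔_; _⊓_; _<?_)
open import Data.Nat.DivMod using (_%_)
open import Data.Fin using (Fin; fromℕ<)
open import Data.Rational using (ℚ; 0ℚ) renaming (_<_ to _<ℚ_)
open import Data.List using (List; []; _∷_; _++_; [_]; map; upTo)
open import Data.List.Relation.Unary.All using (All)
open import Data.List.Relation.Unary.Linked using (Linked)
open import Data.List.Membership.Propositional using (_∈_)
open import Data.List.Relation.Binary.Permutation.Propositional using (_↭_)
open import Data.Product using (Σ; _×_; ∃-syntax)
open import Data.Sum using (_⊎_)
open import Data.Empty using (⊥)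
open import Relation.Nullary using (¬_; yes; no)
open import Relation.Binary.PropositionalEquality using (_≡_; _≢_)

IsEven : ℕ → Set
IsEven k = k % 2 ≡ 0

IsOdd : ℕ → Set
IsOdd k = k % 2 ≡ 1

-- Points of the ambient space R^{2n+1}, modelled over ℚ.

Point : ℕ → Set
Point n = Fin (suc (2 * n)) → ℚ

-- 1-based coordinate access: coord n x k = x_k for 1 ≤ k ≤ 2n+1
-- (junk value 0 outside this range; never used there).
coord : ∀ n → Point n → ℕ → ℚ
coord n x zero = 0ℚ
coord n x (suc k) with k <? suc (2 * n)
... | yes p = x (fromℕ< p)
... | no _  = 0ℚ

-- (p , q) indexes the hyperplane x_p = x_q of K_{2n}
HyperplanePair : ℕ → ℕ → ℕ → Set
HyperplanePair n p q =
  Σ ℕ λ i → Σ ℕ λ j → (1 ≤ i) × (i ≤ j) × (j ≤ n) × (p ≡ 2 * i ∸ 1) × (q ≡ 2 * j)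

InComplement : ∀ n → Point n → Set
InComplement n x = ∀ p q → HyperplanePair n p q → coord n x p ≢ coord n x q

-- x lies in the region of K_{2n} containing the base point r
-- (a region is the set of complement points on the same side of every hyperplane)
InRegionOf : ∀ n → Point n → Point n → Set
InRegionOf n r x =
  InComplement n x ×
  (∀ p q → HyperplanePair n p q →
     (coord n x p <ℚ coord n x q → coord n r p <ℚ coord n r q) ×
     (coord n r p <ℚ coord n r q → coord n x p <ℚ coord n x q))

SameRegion : ∀ n → Point n → Point n → Set
SameRegion n r r' = ∀ x → (InRegionOf n r x → InRegionOf n r' x) × (InRegionOf n r' x → InRegionOf n r x)

IsPermutation : ℕ → List ℕ → Set
IsPermutation n σ = σ ↭ map suc (upTo (2 * n))

Before : List ℕ → ℕ → ℕ → Set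
Before σ a b = Σ (List ℕ) λ α → Σ (List ℕ) λ β → (σ ≡ α ++ a ∷ β) × (b ∈ β)

Compatible : ∀ n → List ℕ → Point n → Set
Compatible n σ r =
  ∀ x → InRegionOf n r x →
  ∀ i j → 1 ≤ i → i < j → j ≤ 2 * n → IsOdd i → IsEven j →
    (Before σ i j → coord n x i <ℚ coord n x j) × (coord n x i <ℚ coord n x j → Before σ i j)

AdjacentAt : List ℕ → List ℕ → ℕ → ℕ → Set
AdjacentAt σ α a b = Σ (List ℕ) λ β → σ ≡ α ++ a ∷ b ∷ β

Adjacent : List ℕ → ℕ → ℕ → Set
Adjacent σ a b = Σ (List ℕ) λ α → AdjacentAt σ α a b

eE eO oO Ee Oe Oo : ℕ → ℕ → Set
eE a b = a < b × IsEven a × IsEven b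
eO a b = a < b × IsEven a × IsOdd b
oO a b = a < b × IsOdd a × IsOdd b
Ee a b = a > b × IsEven a × IsEven b
Oe a b = a > b × IsOdd a × IsEven b
Oo a b = a > b × IsOdd a × IsOdd b

ContainsAdj : (ℕ → ℕ → Set) → List ℕ → Set
ContainsAdj P σ = Σ ℕ λ a → Σ ℕ λ b → Adjacent σ a b × P a b

Split : List ℕ → ℕ → List ℕ → ℕ → Set
Split σ a γ b = Σ (List ℕ) λ α → Σ (List ℕ) λ β → σ ≡ α ++ a ∷ (γ ++ b ∷ β)

maxNE : ℕ → List ℕ → ℕ
maxNE c [] = c
maxNE c (d ∷ ds) = c ⊔ maxNE d ds

minNE : ℕ → List ℕ → ℕ
minNE c [] = c
minNE c (d ∷ ds) = c ⊓ minNE d ds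

Contains-eOd : List ℕ → Set
Contains-eOd σ = Σ ℕ λ a → Σ (List ℕ) λ γ → Σ ℕ λ b →
  Split σ a γ b × IsEven a × All IsOdd γ × IsOdd b × a < b

Contains-Ood : List ℕ → Set
Contains-Ood σ = Σ ℕ λ a → Σ (List ℕ) λ γ → Σ ℕ λ b →
  Split σ a γ b × IsOdd a × IsOdd b × All IsEven γ × OoCond a γ b
  where
  OoCond : ℕ → List ℕ → ℕ → Set
  OoCond a [] b = a > b
  OoCond a (c ∷ cs) b = (a > maxNE c cs) × (maxNE c cs > b)

Contains-Eed : List ℕ → Set
Contains-Eed σ = Σ ℕ λ a → Σ (List ℕ) λ γ → Σ ℕ λ b →
  Split σ a γ b × IsEven a × IsEven b × All IsOdd γ × EeCond a γ b
  where
  EeCond : ℕ → List ℕ → ℕ → Set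
  EeCond a [] b = a > b
  EeCond a (c ∷ cs) b = (a > minNE c cs) × (minNE c cs > b)

OeCondition : List ℕ → Set
OeCondition σ = ∀ α a b → AdjacentAt σ α a b → Oe a b →
  All IsOdd (α ++ [ a ]) × Linked _>_ (α ++ [ a ])

G-II : ℕ → List ℕ → Set
G-II n σ = IsPermutation n σ × ¬ ContainsAdj Ee σ × ¬ ContainsAdj eO σ ×
           ¬ ContainsAdj oO σ × OeCondition σ

G-III : ℕ → List ℕ → Set
G-III n σ = IsPermutation n σ × ¬ ContainsAdj Oo σ × ¬ ContainsAdj eE σ × ¬ Contains-eOd σ

G-IV : ℕ → List ℕ → Set
G-IV n σ = IsPermutation n σ × ¬ ContainsAdj eO σ × ¬ Contains-Ood σ × ¬ Contains-Eed σ

data Family : Set where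
  II III IV : Family

𝔊 : Family → ℕ → List ℕ → Set
𝔊 II  = G-II
𝔊 III = G-III
𝔊 IV  = G-IV

{-# OPTIONS --safe #-}
-- A region of K_2n is determined by the side of each hyperplane x_i = x_j (i odd, j even,
-- i < j), i.e. by the relative order of each such dependent pair of letters. Hence the
-- permutations compatible with a region form one class of words modulo swapping adjacent
-- independent letters. The letters of a word that can be moved to its front are its minimal
-- letters, and each family is cut out by a rule choosing one of them, the head: a word lies in
-- the family iff each of its suffixes starts with its own head. II takes the largest minimal odd
-- letter if there is one and else the smallest minimal even letter; III the smallest odd, else
-- the largest even; IV the smallest even or the smallest odd letter, according to whether an odd
-- first letter would force an Oo_d pattern. A class contains exactly one such greedy word.
-- Sorting the letters by the coordinates of a point of a region gives a word of its class, and
-- the positions of the letters of a word give a point of its region.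
module Submission where

open import Defs
open import Data.Nat using (ℕ; suc; pred; _+_; _*_; _∸_; _≤_; _<_; _>_; z≤n; s≤s; _≟_; _<?_)
open import Data.Nat.Properties
  using (≤-refl; ≤-trans; <-trans; <-irrefl; ≤∧≢⇒<; ≮⇒≥; <⇒≱; <⇒≤; <⇒≢; ≤-<-trans; <-≤-trans; ≤-pred; n≤1+n;
         ≤-isTotalOrder; suc-injective; ⊔-lub; ⊓-glb; ⊔-sel; m≤m⊔n; m≤n⊔m; m⊓n≤m; m⊓n≤n;
         *-suc; *-comm; *-cancelˡ-≤; *-mono-≤)
open import Data.Nat.DivMod using (_%_; _/_; m%n<n; m≡m%n+[m/n]*n; [m+kn]%n≡m%n; m*n%n≡0)
open import Data.Nat.Coprimality using (1-coprimeTo) renaming (sym to coprime-sym)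
open import Data.Integer as ℤ using (+_; +<+)
import Data.Integer.Properties as ℤ
open import Data.Rational as ℚ using (ℚ; mkℚ; *<*)
import Data.Rational.Properties as ℚ
open import Data.Fin using (toℕ)
open import Data.Fin.Properties using (toℕ-fromℕ<)
open import Data.List using (List; []; _∷_; _++_; [_]; filter; length; map; upTo)
open import Data.List.Properties using (++-assoc; length-++-≤ʳ)
open import Data.List.Relation.Unary.All as All using (All; []; _∷_; all?)
import Data.List.Relation.Unary.All.Properties as All
open import Data.List.Relation.Unary.Any as Any using (Any; here; there; any?)
open import Data.List.Relation.Unary.AllPairs using (AllPairs; _∷_)
open import Data.List.Relation.Unary.Linked using (Linked; []; [-]; _∷_)
open import Data.List.Relation.Unary.Linked.Properties using (Linked⇒AllPairs)
import Data.List.Relation.Unary.First as First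
open import Data.List.Relation.Unary.First.Properties using (toView)
open import Data.List.Relation.Unary.Unique.Propositional as Unique using (Unique; _∷_)
open import Data.List.Relation.Unary.Unique.Propositional.Properties using (Unique[x∷xs]⇒x∉xs; map⁺; upTo⁺)
open import Data.List.Membership.Propositional using (_∈_; find; lose)
open import Data.List.Membership.Propositional.Properties
  using (∈-∃++; ∈-++⁺ˡ; ∈-++⁺ʳ; ∈-filter⁺; ∈-map⁺; ∈-map⁻; ∈-upTo⁺; ∈-upTo⁻)
open import Data.List.Membership.DecPropositional using () renaming (_∈?_ to member?)
open import Data.List.Relation.Binary.Permutation.Propositional
  using (_↭_; ↭-refl; ↭-sym; ↭-trans; ↭-prep; ↭-swap; ↭⇒↭ₛ)
open import Data.List.Relation.Binary.Permutation.Propositional.Properties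
  using (∈-resp-↭; Any-resp-↭; All-resp-↭; drop-∷; ↭-empty-inv; ↭-length)
import Data.List.Relation.Binary.Permutation.Setoid.Properties as ↭ₛ
import Data.List.Extrema as Extrema
import Data.List.Sort as Sort
open import Data.Product using (Σ; ∃; ∃₂; _×_; _,_; proj₁; proj₂)
open import Data.Sum as Sum using (_⊎_; inj₁; inj₂; swap)
open import Data.Empty using (⊥)
open import Function.Base using (_∘_; _∘′_; id; flip)
open import Function.Bundles using (_⇔_; mk⇔; Equivalence)
open import Level using (0ℓ)
open import Relation.Nullary using (¬_; Dec; yes; no; contradiction)
open import Relation.Nullary.Decidable using (decidable-stable; ¬?; _×-dec_; _⊎-dec_; _→-dec_)
open import Relation.Binary.Core using (Rel)
open import Relation.Binary.Bundles using (TotalOrder)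
open import Relation.Binary.Structures using (IsTotalOrder)
open import Relation.Binary.Definitions using (Symmetric; Decidable; DecidableEquality; tri<; tri≈; tri>)
open import Relation.Binary.PropositionalEquality
  using (_≡_; _≢_; refl; sym; trans; cong; cong₂; subst; subst₂; setoid; module ≡-Reasoning)
import Relation.Binary.Construct.Flip.EqAndOrd as Flip
import Relation.Binary.Construct.On as On

open Equivalence using (to; from)

private variable
  a b c e i j k n o x y B : ℕ

-- Wrapping IsEven/IsOdd in records makes k recoverable from a proof.
record Even (k : ℕ) : Set where
  constructor even
  field isEven : IsEven k

record Odd (k : ℕ) : Set where
  constructor odd
  field isOdd : IsOdd k

parity : ∀ k → Even k ⊎ Odd k
parity k with k % 2 in eq | m%n<n k 2
... | 0           | _               = inj₁ (even eq)
... | 1           | _               = inj₂ (odd eq)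
... | suc (suc _) | s≤s (s≤s ())

even⇒¬odd : Even k → ¬ Odd k
even⇒¬odd (even e) (odd o) with () ← trans (sym e) o

even≢odd : Even a → Odd b → a ≢ b
even≢odd ea ob refl = even⇒¬odd ea ob

even? : ∀ k → Dec (Even k)
even? k with parity k
... | inj₁ e = yes e
... | inj₂ o = no λ e → even⇒¬odd e o

odd? : ∀ k → Dec (Odd k)
odd? k with parity k
... | inj₁ e = no (even⇒¬odd e)
... | inj₂ o = yes o

-- Dependent letters: the pairs cut by a hyperplane of K_2n

OddBelowEven : ℕ → ℕ → Set
OddBelowEven i j = Odd i × Even j × i < j

Dependent : ℕ → ℕ → Set
Dependent a b = OddBelowEven a b ⊎ OddBelowEven b a

Dependent-sym : Symmetric Dependent
Dependent-sym = swap

Dependent? : Decidable Dependent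
Dependent? a b = oddBelowEven? a b ⊎-dec oddBelowEven? b a
  where
  oddBelowEven? : ∀ i j → Dec (OddBelowEven i j)
  oddBelowEven? i j = odd? i ×-dec even? j ×-dec i <? j

even-even-independent : Even a → Even b → ¬ Dependent a b
even-even-independent ea eb (inj₁ (oa , _)) = even⇒¬odd ea oa
even-even-independent ea eb (inj₂ (ob , _)) = even⇒¬odd eb ob

odd-odd-independent : Odd a → Odd b → ¬ Dependent a b
odd-odd-independent oa ob (inj₁ (_ , eb , _)) = even⇒¬odd eb ob
odd-odd-independent oa ob (inj₂ (_ , ea , _)) = even⇒¬odd ea oa

odd-above-even-independent : Odd a → Even b → b < a → ¬ Dependent a b
odd-above-even-independent oa eb b<a (inj₁ (_ , _ , a<b)) = <-irrefl refl (<-trans a<b b<a)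
odd-above-even-independent oa eb b<a (inj₂ (ob , _)) = even⇒¬odd eb ob

independent-odd-even : Odd a → Even b → ¬ Dependent a b → b < a
independent-odd-even oa eb a≁b =
  ≤∧≢⇒< (≮⇒≥ λ a<b → a≁b (inj₁ (oa , eb , a<b))) (λ b≡a → even≢odd eb oa b≡a)

independent-even-odd : Even a → Odd b → ¬ Dependent a b → a < b
independent-even-odd ea ob a≁b = independent-odd-even ob ea (a≁b ∘ Dependent-sym)

even-below-odd-independent : Even a → Odd b → a < b → ¬ Dependent a b
even-below-odd-independent ea ob a<b = odd-above-even-independent ob ea a<b ∘ Dependent-sym

-- Words up to commutation of independent letters

module Traces {A : Set} (D : Rel A 0ℓ) (D-sym : Symmetric D) where

  private variable
    p q u v w : List A
    s t z : A

  data Precedes : List A → A → A → Set where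
    now   : t ∈ w → Precedes (s ∷ w) s t
    later : Precedes w s t → Precedes (z ∷ w) s t

  precedes⇒∈ˡ : Precedes w s t → s ∈ w
  precedes⇒∈ˡ (now _)   = here refl
  precedes⇒∈ˡ (later x) = there (precedes⇒∈ˡ x)

  precedes⇒∈ʳ : Precedes w s t → t ∈ w
  precedes⇒∈ʳ (now t∈w) = there t∈w
  precedes⇒∈ʳ (later x) = there (precedes⇒∈ʳ x)

  precedes-total : Unique w → s ∈ w → t ∈ w → s ≢ t → Precedes w s t ⊎ Precedes w t s
  precedes-total u (here refl) (here refl) s≢t = contradiction refl s≢t
  precedes-total u (here refl) (there t∈w) s≢t = inj₁ (now t∈w)
  precedes-total u (there s∈w) (here refl) s≢t = inj₂ (now s∈w)
  precedes-total (_ ∷ u) (there s∈w) (there t∈w) s≢t =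
    Sum.map later later (precedes-total u s∈w t∈w s≢t)

  precedes-asym : Unique w → Precedes w s t → ¬ Precedes w t s
  precedes-asym u (now t∈w) (now _)   = Unique[x∷xs]⇒x∉xs u t∈w
  precedes-asym u (now _)   (later y) = Unique[x∷xs]⇒x∉xs u (precedes⇒∈ʳ y)
  precedes-asym u (later x) (now _)   = Unique[x∷xs]⇒x∉xs u (precedes⇒∈ʳ x)
  precedes-asym (_ ∷ u) (later x) (later y) = precedes-asym u x y

  ∈-prefix⇒precedes : ∀ p → s ∈ p → Precedes (p ++ t ∷ q) s t
  ∈-prefix⇒precedes (_ ∷ p) (here refl) = now (∈-++⁺ʳ p (here refl))
  ∈-prefix⇒precedes (_ ∷ p) (there s∈p) = later (∈-prefix⇒precedes p s∈p)

  precedes⇒∈-prefix : ∀ p → Unique (p ++ t ∷ q) → Precedes (p ++ t ∷ q) s t → s ∈ p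
  precedes⇒∈-prefix []      u (now s∈q) = contradiction s∈q (Unique[x∷xs]⇒x∉xs u)
  precedes⇒∈-prefix []      u (later x) = contradiction (precedes⇒∈ʳ x) (Unique[x∷xs]⇒x∉xs u)
  precedes⇒∈-prefix (_ ∷ p) u (now _)   = here refl
  precedes⇒∈-prefix (_ ∷ p) (_ ∷ u) (later x) = there (precedes⇒∈-prefix p u x)

  AllPairs⇒precedes : ∀ {R : Rel A 0ℓ} → AllPairs R w → Precedes w s t → R s t
  AllPairs⇒precedes (r ∷ _)  (now t∈w) = All.lookup r t∈w
  AllPairs⇒precedes (_ ∷ rs) (later x) = AllPairs⇒precedes rs x

  Unique-resp-↭ : u ↭ v → Unique u → Unique v
  Unique-resp-↭ u↭v = ↭ₛ.Unique-resp-↭ (setoid A) (↭⇒↭ₛ u↭v)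

  infix 4 _∼_
  record _∼_ (u v : List A) : Set where
    field
      permutation : u ↭ v
      preserves   : D s t → Precedes u s t → Precedes v s t
      reflects    : D s t → Precedes v s t → Precedes u s t
  open _∼_ public

  ∼-refl : w ∼ w
  ∼-refl = record { permutation = ↭-refl ; preserves = λ _ x → x ; reflects = λ _ x → x }

  ∼-sym : u ∼ v → v ∼ u
  ∼-sym u∼v = record
    { permutation = ↭-sym (permutation u∼v) ; preserves = reflects u∼v ; reflects = preserves u∼v }

  ∼-trans : u ∼ v → v ∼ w → u ∼ w
  ∼-trans u∼v v∼w = record
    { permutation = ↭-trans (permutation u∼v) (permutation v∼w)
    ; preserves   = λ d → preserves v∼w d ∘ preserves u∼v d
    ; reflects    = λ d → reflects u∼v d ∘ reflects v∼w d
    }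

  ∼-∷ : u ∼ v → z ∷ u ∼ z ∷ v
  ∼-∷ {u} {v} u∼v = record
    { permutation = ↭-prep _ (permutation u∼v)
    ; preserves   = step (permutation u∼v) (preserves u∼v)
    ; reflects    = step (↭-sym (permutation u∼v)) (reflects u∼v)
    }
    where
    step : ∀ {u v} → u ↭ v → (∀ {s t} → D s t → Precedes u s t → Precedes v s t) →
           D s t → Precedes (z ∷ u) s t → Precedes (z ∷ v) s t
    step u↭v f d (now t∈u) = now (∈-resp-↭ u↭v t∈u)
    step u↭v f d (later x) = later (f d x)

  ∼-∷⁻ : Unique (z ∷ u) → Unique (z ∷ v) → z ∷ u ∼ z ∷ v → u ∼ v
  ∼-∷⁻ uu uv zu∼zv = record
    { permutation = drop-∷ (permutation zu∼zv)
    ; preserves   = step uu (preserves zu∼zv)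
    ; reflects    = step uv (reflects zu∼zv)
    }
    where
    step : ∀ {u v} → Unique (z ∷ u) →
           (∀ {s t} → D s t → Precedes (z ∷ u) s t → Precedes (z ∷ v) s t) →
           D s t → Precedes u s t → Precedes v s t
    step uu f d x with f d (later x)
    ... | now _   = contradiction (precedes⇒∈ˡ x) (Unique[x∷xs]⇒x∉xs uu)
    ... | later y = y

  ∼-swap : ¬ D s t → s ∷ t ∷ w ∼ t ∷ s ∷ w
  ∼-swap {s} {t} s≁t = record
    { permutation = ↭-swap _ _ ↭-refl
    ; preserves   = step s≁t
    ; reflects    = step (s≁t ∘ D-sym)
    }
    where
    step : ∀ {s t s′ t′} → ¬ D s t → D s′ t′ → Precedes (s ∷ t ∷ w) s′ t′ → Precedes (t ∷ s ∷ w) s′ t′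
    step s≁t d (now (here refl))   = contradiction d s≁t
    step s≁t d (now (there b∈w))   = later (now b∈w)
    step s≁t d (later (now b∈w))   = now (there b∈w)
    step s≁t d (later (later x))   = later (later x)

  ∼-front : ∀ p → All (¬_ ∘ D z) p → z ∷ p ++ q ∼ p ++ z ∷ q
  ∼-front []      []           = ∼-refl
  ∼-front (s ∷ p) (z≁s ∷ z≁p) = ∼-trans (∼-swap z≁s) (∼-∷ (∼-front p z≁p))

  Minimal : List A → A → Set
  Minimal w t = t ∈ w × (∀ {s} → Precedes w s t → ¬ D s t)

  minimal-head : Unique (t ∷ w) → Minimal (t ∷ w) t
  minimal-head u = here refl , λ
    { (now t∈w) _ → Unique[x∷xs]⇒x∉xs u t∈w
    ; (later x) _ → Unique[x∷xs]⇒x∉xs u (precedes⇒∈ʳ x) }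

  minimal-after : ∀ p → Unique (p ++ t ∷ q) → All (λ s → ¬ D s t) p → Minimal (p ++ t ∷ q) t
  minimal-after p u p≁t = ∈-++⁺ʳ p (here refl) , All.lookup p≁t ∘ precedes⇒∈-prefix p u

  minimal-within : ∀ p → Unique (p ++ q) → t ∈ p → All (λ s → ¬ D s t) p → Minimal (p ++ q) t
  minimal-within {q} {t} p u t∈p p≁t with p₁ , p₂ , refl ← ∈-∃++ t∈p
    rewrite ++-assoc p₁ (t ∷ p₂) q = minimal-after p₁ u (All.++⁻ˡ p₁ p≁t)

  minimal-split : Minimal w t → ∃₂ λ p q → w ≡ p ++ t ∷ q × All (λ s → ¬ D s t) p
  minimal-split (t∈w , min) with p , q , refl ← ∈-∃++ t∈w =
    p , q , refl , All.tabulate (min ∘ ∈-prefix⇒precedes p)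

  minimal-∷ : Minimal (s ∷ w) t → t ≡ s ⊎ ∃₂ λ p q → w ≡ p ++ t ∷ q × All (λ z → ¬ D z t) (s ∷ p)
  minimal-∷ min with minimal-split min
  ... | []    , _ , refl , _     = inj₁ refl
  ... | _ ∷ p , q , refl , p≁t = inj₂ (p , q , refl , p≁t)

  minimal-resp-∼ : u ∼ v → Minimal u t → Minimal v t
  minimal-resp-∼ u∼v (t∈u , min) =
    ∈-resp-↭ (permutation u∼v) t∈u , λ x d → min (reflects u∼v d x) d

  minimal⇒front : Minimal w t → ∃ λ rest → t ∷ rest ∼ w
  minimal⇒front min with p , q , refl , p≁t ← minimal-split min =
    p ++ q , ∼-front p (All.map (_∘ D-sym) p≁t)

  module Decision (_≟_ : DecidableEquality A) (D? : Decidable D) where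

    all-preceding? : ∀ {P : A → Set} → (∀ s → Dec (P s)) → ∀ w t → Dec (∀ {s} → Precedes w s t → P s)
    all-preceding? P? []      t = yes λ ()
    all-preceding? P? (s ∷ w) t with member? _≟_ t w →-dec P? s | all-preceding? P? w t
    ... | yes now-ok | yes later-ok = yes λ { (now t∈w) → now-ok t∈w ; (later x) → later-ok x }
    ... | no ¬now-ok | _            = no λ all → ¬now-ok (all ∘ now)
    ... | _          | no ¬later-ok = no λ all → ¬later-ok (all ∘ later)

    minimal? : ∀ w t → Dec (Minimal w t)
    minimal? w t = member? _≟_ t w ×-dec all-preceding? (λ s → ¬? (D? s t)) w t

  record HeadRule : Set₁ where
    field
      Head         : List A → A → Set
      head-minimal : Head w t → Minimal w t
      head-unique  : Head w s → Head w t → s ≡ t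
      head-exists  : Unique (z ∷ w) → ∃ (Head (z ∷ w))
      head-resp-∼  : u ∼ v → Head u t → Head v t

  module NormalForms (rule : HeadRule) where
    open HeadRule rule

    data NormalForm : List A → Set where
      []  : NormalForm []
      _∷_ : Head (t ∷ w) t → NormalForm w → NormalForm (t ∷ w)

    normalForm-unique : Unique u → Unique v → u ∼ v → NormalForm u → NormalForm v → u ≡ v
    normalForm-unique _ _ u∼v [] []      = refl
    normalForm-unique _ _ u∼v [] (_ ∷ _) with () ← ↭-empty-inv (↭-sym (permutation u∼v))
    normalForm-unique _ _ u∼v (_ ∷ _) [] with () ← ↭-empty-inv (permutation u∼v)
    normalForm-unique uu@(_ ∷ uu′) uv@(_ ∷ uv′) u∼v (hs ∷ nu) (ht ∷ nv)
      with refl ← head-unique (head-resp-∼ u∼v hs) ht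
      = cong (_ ∷_) (normalForm-unique uu′ uv′ (∼-∷⁻ uu uv u∼v) nu nv)

    normalise : Unique w → ∃ λ σ → NormalForm σ × σ ∼ w
    normalise {w} = go (length w) w refl
      where
      go : ∀ n w → length w ≡ n → Unique w → ∃ λ σ → NormalForm σ × σ ∼ w
      go _       []      _   _ = [] , [] , ∼-refl
      go (suc n) (z ∷ w) len u
        with t , h ← head-exists u
        with rest , front ← minimal⇒front (head-minimal h)
        with σ , nσ , σ∼rest ← go n rest (cong pred (trans (↭-length (permutation front)) len))
                                  (Unique.tail (Unique-resp-↭ (↭-sym (permutation front)) u))
        = t ∷ σ , head-resp-∼ (∼-sym tσ∼w) h ∷ nσ , tσ∼w
        where
        tσ∼w : t ∷ σ ∼ z ∷ w
        tσ∼w = ∼-trans (∼-∷ σ∼rest) front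

    record NormalFormCriterion (P : List A → Set) : Set where
      field
        nil        : P []
        tail       : P (t ∷ w) → P w
        head-first : Unique (t ∷ w) → P (t ∷ w) → Head (t ∷ w) t
        extend     : Unique (t ∷ w) → Head (t ∷ w) t → P w → P (t ∷ w)

    module _ {P : List A → Set} (criterion : NormalFormCriterion P) where
      open NormalFormCriterion criterion

      criterion⇒normalForm : Unique w → P w → NormalForm w
      criterion⇒normalForm {[]}    _          _  = []
      criterion⇒normalForm {t ∷ w} u@(_ ∷ u′) Pw = head-first u Pw ∷ criterion⇒normalForm u′ (tail Pw)

      normalForm⇒criterion : Unique w → NormalForm w → P w
      normalForm⇒criterion _          []       = nil
      normalForm⇒criterion u@(_ ∷ u′) (h ∷ nw) = extend u h (normalForm⇒criterion u′ nw)

least : (O : TotalOrder 0ℓ 0ℓ 0ℓ) → let open TotalOrder O using (Carrier) renaming (_≤_ to _⊑_) in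
        ∀ {P : Carrier → Set} → (∀ s → Dec (P s)) → ∀ xs {s} → P s →
        ∃ λ m → P m × (∀ {t} → t ∈ xs → P t → m ⊑ t)
least O P? xs Ps =
  min _ candidates , argmin-all id Ps (All.all-filter P? xs) ,
  λ t∈xs Pt → All.lookup (min≤xs _ candidates) (∈-filter⁺ P? t∈xs Pt)
  where
  open Extrema O
  candidates = filter P? xs

open Traces Dependent Dependent-sym
open Decision _≟_ Dependent?

private variable
  u v w w′ p q β γ σ τ : List ℕ
  R : ℕ → ℕ → Set
  Q : ℕ → List ℕ → ℕ → Set

module ParityHeads
  (_≤ₒ_ : Rel ℕ 0ℓ) (≤ₒ-isTotalOrder : IsTotalOrder _≡_ _≤ₒ_)
  (_≤ₑ_ : Rel ℕ 0ℓ) (≤ₑ-isTotalOrder : IsTotalOrder _≡_ _≤ₑ_)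
  (EvenFirst : List ℕ → Set)
  (evenFirst? : ∀ w → Dec (EvenFirst w))
  (evenFirst-resp-∼ : ∀ {u v} → u ∼ v → EvenFirst u → EvenFirst v)
  (evenFirst⇒minimal-even : ∀ {x w} → Unique (x ∷ w) → EvenFirst (x ∷ w) → ∃ λ e → Minimal (x ∷ w) e × Even e)
  (¬evenFirst⇒minimal-odd : ∀ {x w} → Unique (x ∷ w) → ¬ EvenFirst (x ∷ w) → ∃ λ o → Minimal (x ∷ w) o × Odd o)
  where

  data Head (w : List ℕ) (x : ℕ) : Set where
    even-head : Minimal w x → EvenFirst w → Even x → (∀ {e} → Minimal w e → Even e → x ≤ₑ e) → Head w x
    odd-head  : Minimal w x → ¬ EvenFirst w → Odd x → (∀ {o} → Minimal w o → Odd o → x ≤ₒ o) → Head w x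

  private
    module ≤ₒ = IsTotalOrder ≤ₒ-isTotalOrder
    module ≤ₑ = IsTotalOrder ≤ₑ-isTotalOrder

    head-minimal : Head w x → Minimal w x
    head-minimal (even-head m _ _ _) = m
    head-minimal (odd-head  m _ _ _) = m

    head-unique : Head w x → Head w y → x ≡ y
    head-unique (even-head mx _ ex x≤) (even-head my _ ey y≤) = ≤ₑ.antisym (x≤ my ey) (y≤ mx ex)
    head-unique (odd-head  mx _ ox x≤) (odd-head  my _ oy y≤) = ≤ₒ.antisym (x≤ my oy) (y≤ mx ox)
    head-unique (even-head _ even-first _ _) (odd-head _ odd-first _ _) = contradiction even-first odd-first
    head-unique (odd-head _ odd-first _ _) (even-head _ even-first _ _) = contradiction even-first odd-first

    head-exists : ∀ {x w} → Unique (x ∷ w) → ∃ (Head (x ∷ w))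
    head-exists {x} {w} u with evenFirst? (x ∷ w)
    ... | yes even-first with _ , e-min , e-even ← evenFirst⇒minimal-even u even-first
      with m , (m-min , m-even) , m≤ ← least (record { isTotalOrder = ≤ₑ-isTotalOrder })
                                        (λ e → minimal? (x ∷ w) e ×-dec even? e) (x ∷ w) (e-min , e-even)
      = m , even-head m-min even-first m-even (λ e-min e-even → m≤ (proj₁ e-min) (e-min , e-even))
    head-exists {x} {w} u | no odd-first with _ , o-min , o-odd ← ¬evenFirst⇒minimal-odd u odd-first
      with m , (m-min , m-odd) , m≤ ← least (record { isTotalOrder = ≤ₒ-isTotalOrder })
                                        (λ o → minimal? (x ∷ w) o ×-dec odd? o) (x ∷ w) (o-min , o-odd)
      = m , odd-head m-min odd-first m-odd (λ o-min o-odd → m≤ (proj₁ o-min) (o-min , o-odd))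

    head-resp-∼ : u ∼ v → Head u x → Head v x
    head-resp-∼ u∼v (even-head m even-first e x≤) =
      even-head (minimal-resp-∼ u∼v m) (evenFirst-resp-∼ u∼v even-first) e (x≤ ∘ minimal-resp-∼ (∼-sym u∼v))
    head-resp-∼ u∼v (odd-head m odd-first o x≤) =
      odd-head (minimal-resp-∼ u∼v m) (odd-first ∘ evenFirst-resp-∼ (∼-sym u∼v)) o
               (x≤ ∘ minimal-resp-∼ (∼-sym u∼v))

  rule : HeadRule
  rule = record
    { Head = Head ; head-minimal = head-minimal ; head-unique = head-unique
    ; head-exists = head-exists ; head-resp-∼ = head-resp-∼ }

  open NormalForms rule public

  even-head⁻ : Head w x → Even x → EvenFirst w × (∀ {e} → Minimal w e → Even e → x ≤ₑ e)
  even-head⁻ (even-head _ even-first _ x≤) _  = even-first , x≤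
  even-head⁻ (odd-head _ _ ox _)     ex = contradiction ox (even⇒¬odd ex)

  odd-head⁻ : Head w x → Odd x → ¬ EvenFirst w × (∀ {o} → Minimal w o → Odd o → x ≤ₒ o)
  odd-head⁻ (odd-head _ odd-first _ x≤) _  = odd-first , x≤
  odd-head⁻ (even-head _ _ ex _)    ox = contradiction ox (even⇒¬odd ex)

NoMinimalOdd : List ℕ → Set
NoMinimalOdd w = ¬ Any (λ o → Minimal w o × Odd o) w

noMinimalOdd? : ∀ w → Dec (NoMinimalOdd w)
noMinimalOdd? w = ¬? (any? (λ o → minimal? w o ×-dec odd? o) w)

noMinimalOdd-resp-∼ : u ∼ v → NoMinimalOdd u → NoMinimalOdd v
noMinimalOdd-resp-∼ u∼v none any with o , o∈v , o-min , o-odd ← find any =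
  none (lose (∈-resp-↭ (↭-sym (permutation u∼v)) o∈v) (minimal-resp-∼ (∼-sym u∼v) o-min , o-odd))

noMinimalOdd⇒minimal-even : Unique (x ∷ w) → NoMinimalOdd (x ∷ w) → ∃ λ e → Minimal (x ∷ w) e × Even e
noMinimalOdd⇒minimal-even {x} u none with parity x
... | inj₁ ex = x , minimal-head u , ex
... | inj₂ ox = contradiction (here (minimal-head u , ox)) none

noMinimalOdd⇒¬odd : NoMinimalOdd w → Minimal w x → ¬ Odd x
noMinimalOdd⇒¬odd none min ox = none (lose (proj₁ min) (min , ox))

¬noMinimalOdd⇒minimal-odd : ¬ NoMinimalOdd w → ∃ λ o → Minimal w o × Odd o
¬noMinimalOdd⇒minimal-odd {w} some
  with _ , _ , found ← find (decidable-stable (any? (λ o → minimal? w o ×-dec odd? o) w) some) = _ , found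

noAdj-[] : ¬ ContainsAdj R []
noAdj-[] (_ , _ , ([]    , _ , ()) , _)
noAdj-[] (_ , _ , (_ ∷ _ , _ , ()) , _)

noAdj-tail : ¬ ContainsAdj R (x ∷ w) → ¬ ContainsAdj R w
noAdj-tail none (a , b , (α , β , eq) , r) = none (a , b , (_ ∷ α , β , cong (_ ∷_) eq) , r)

noAdj-head : ¬ ContainsAdj R (x ∷ y ∷ w) → ¬ R x y
noAdj-head {w = w} none r = none (_ , _ , ([] , w , refl) , r)

noAdj-∷ : (∀ {y w′} → w ≡ y ∷ w′ → ¬ R x y) → ¬ ContainsAdj R w → ¬ ContainsAdj R (x ∷ w)
noAdj-∷ head-free none (_ , _ , ([]    , _ , refl) , r) = head-free refl r
noAdj-∷ head-free none (a , b , (_ ∷ α , β , refl) , r) = none (a , b , (α , β , refl) , r)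

ContainsSplit : (ℕ → List ℕ → ℕ → Set) → List ℕ → Set
ContainsSplit Q σ = Σ ℕ λ a → Σ (List ℕ) λ γ → Σ ℕ λ b → Split σ a γ b × Q a γ b

noSplit-[] : ¬ ContainsSplit Q []
noSplit-[] (_ , _ , _ , ([]    , _ , ()) , _)
noSplit-[] (_ , _ , _ , (_ ∷ _ , _ , ()) , _)

noSplit-tail : ¬ ContainsSplit Q (x ∷ w) → ¬ ContainsSplit Q w
noSplit-tail none (a , γ , b , (α , β , eq) , r) = none (a , γ , b , (_ ∷ α , β , cong (_ ∷_) eq) , r)

noSplit-head : ¬ ContainsSplit Q (x ∷ γ ++ y ∷ w) → ¬ Q x γ y
noSplit-head {γ = γ} {w = w} none r = none (_ , γ , _ , ([] , w , refl) , r)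

noSplit-∷ : (∀ {γ y w′} → w ≡ γ ++ y ∷ w′ → ¬ Q x γ y) → ¬ ContainsSplit Q w → ¬ ContainsSplit Q (x ∷ w)
noSplit-∷ head-free none (_ , _ , _ , ([]    , _ , refl) , r) = head-free refl r
noSplit-∷ head-free none (a , γ , b , (_ ∷ α , β , refl) , r) = none (a , γ , b , (α , β , refl) , r)

-- Family II

AvoidsII : List ℕ → Set
AvoidsII σ = ¬ ContainsAdj Ee σ × ¬ ContainsAdj eO σ × ¬ ContainsAdj oO σ × OeCondition σ

oeCondition-tail : OeCondition (x ∷ w) → OeCondition w
oeCondition-tail {x} oe α a b (β , eq) Oe-ab with _ ∷ α-odd , desc ← oe (x ∷ α) a b (β , cong (x ∷_) eq) Oe-ab =
  α-odd , Linked-tail desc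
  where
  Linked-tail : ∀ {l} → Linked _>_ (x ∷ l) → Linked _>_ l
  Linked-tail [-]     = []
  Linked-tail (_ ∷ l) = l

oeCondition-[] : OeCondition []
oeCondition-[] []      _ _ (_ , ()) _
oeCondition-[] (_ ∷ _) _ _ (_ , ()) _

avoidsII-tail : AvoidsII (x ∷ w) → AvoidsII w
avoidsII-tail (noEe , noeO , nooO , oe) =
  noAdj-tail noEe , noAdj-tail noeO , noAdj-tail nooO , oeCondition-tail oe

oeCondition⇒noOe : Even x → OeCondition (x ∷ w) → ¬ ContainsAdj Oe (x ∷ w)
oeCondition⇒noOe ex oe (a , b , ([]    , β , refl) , Oe-ab) with oa ∷ _ , _ ← oe [] a b (β , refl) Oe-ab =
  even⇒¬odd ex (odd oa)
oeCondition⇒noOe ex oe (a , b , (_ ∷ α , β , refl) , Oe-ab) with ox ∷ _ , _ ← oe (_ ∷ α) a b (β , refl) Oe-ab =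
  even⇒¬odd ex (odd ox)

descending⇒≥last : ∀ l → Linked _>_ (l ++ [ a ]) → All (a ≤_) (l ++ [ a ])
descending⇒≥last []          _          = ≤-refl ∷ []
descending⇒≥last (c ∷ [])    (c>a ∷ _)  = <⇒≤ c>a ∷ ≤-refl ∷ []
descending⇒≥last (c ∷ d ∷ l) (c>d ∷ desc) with a≤d ∷ rest ← descending⇒≥last (d ∷ l) desc =
  ≤-trans a≤d (<⇒≤ c>d) ∷ a≤d ∷ rest

module II = ParityHeads (flip _≤_) (Flip.isTotalOrder ≤-isTotalOrder) _≤_ ≤-isTotalOrder
  NoMinimalOdd noMinimalOdd? noMinimalOdd-resp-∼ noMinimalOdd⇒minimal-even (λ _ → ¬noMinimalOdd⇒minimal-odd)

II-before-minimal-odd : ∀ p → ¬ ContainsAdj eO (p ++ y ∷ q) → ¬ ContainsAdj oO (p ++ y ∷ q) → Odd y →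
                        All (λ z → ¬ Dependent z y) p → All (λ z → Odd z × y ≤ z) p
II-before-minimal-odd []      _    _    _  _ = []
II-before-minimal-odd {y} {q} (z ∷ p) noeO nooO oy (z≁y ∷ p≁y) =
  next-bound p rest noeO nooO ∷ rest
  where
  rest = II-before-minimal-odd p (noAdj-tail noeO) (noAdj-tail nooO) oy p≁y
  step : Odd n → y ≤ n → ¬ eO z n → ¬ oO z n → Odd z × y ≤ z
  step on y≤n ¬eO ¬oO with parity z
  ... | inj₁ ez =
    contradiction (<-≤-trans (independent-even-odd ez oy z≁y) y≤n , Even.isEven ez , Odd.isOdd on) ¬eO
  ... | inj₂ oz = oz , ≤-trans y≤n (≮⇒≥ λ z<n → ¬oO (z<n , Odd.isOdd oz , Odd.isOdd on))
  next-bound : ∀ p → All (λ z → Odd z × y ≤ z) p → ¬ ContainsAdj eO (z ∷ p ++ y ∷ q) →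
               ¬ ContainsAdj oO (z ∷ p ++ y ∷ q) → Odd z × y ≤ z
  next-bound []      []               noeO nooO = step oy ≤-refl (noAdj-head noeO) (noAdj-head nooO)
  next-bound (c ∷ _) ((oc , y≤c) ∷ _) noeO nooO = step oc y≤c (noAdj-head noeO) (noAdj-head nooO)

no-descent-to-even : ¬ ContainsAdj Ee (c ∷ y ∷ w) → ¬ ContainsAdj Oe (c ∷ y ∷ w) → Even y → c ≤ y
no-descent-to-even {c} noEe noOe ey with parity c
... | inj₁ ec = ≮⇒≥ λ y<c → noAdj-head noEe (y<c , Even.isEven ec , Even.isEven ey)
... | inj₂ oc = ≮⇒≥ λ y<c → noAdj-head noOe (y<c , Odd.isOdd oc , Even.isEven ey)

II-before-minimal-even : ∀ p → ¬ ContainsAdj Ee (c ∷ p ++ y ∷ q) → ¬ ContainsAdj Oe (c ∷ p ++ y ∷ q) →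
                         Even y → All (λ z → ¬ Dependent z y) p → c ≤ y
II-before-minimal-even []      noEe noOe ey []          = no-descent-to-even noEe noOe ey
II-before-minimal-even (z ∷ p) noEe noOe ey (z≁y ∷ p≁y)
  with parity z | II-before-minimal-even p (noAdj-tail noEe) (noAdj-tail noOe) ey p≁y
... | inj₂ oz | z≤y = contradiction z≤y (<⇒≱ (independent-odd-even oz ey z≁y))
... | inj₁ ez | z≤y = ≤-trans (no-descent-to-even noEe noOe ez) z≤y

II-head-first : Unique (x ∷ w) → AvoidsII (x ∷ w) → II.Head (x ∷ w) x
II-head-first {x} u (noEe , noeO , nooO , oe) with parity x
... | inj₂ ox = II.odd-head (minimal-head u) (λ none → noMinimalOdd⇒¬odd none (minimal-head u) ox) ox x≥
  where
  x≥ : ∀ {o} → Minimal (x ∷ _) o → Odd o → o ≤ x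
  x≥ min oo with minimal-∷ min
  ... | inj₁ refl                  = ≤-refl
  ... | inj₂ (p , _ , refl , x∷p≁o) = proj₂ (All.head (II-before-minimal-odd (x ∷ p) noeO nooO oo x∷p≁o))
... | inj₁ ex = II.even-head (minimal-head u) noOdd ex x≤
  where
  noOdd : NoMinimalOdd (x ∷ _)
  noOdd any with _ , _ , min , oo ← find any with minimal-∷ min
  ... | inj₁ refl                  = even⇒¬odd ex oo
  ... | inj₂ (p , _ , refl , x∷p≁o) =
    even⇒¬odd ex (proj₁ (All.head (II-before-minimal-odd (x ∷ p) noeO nooO oo x∷p≁o)))
  x≤ : ∀ {e} → Minimal (x ∷ _) e → Even e → x ≤ e
  x≤ min ee with minimal-∷ min
  ... | inj₁ refl                     = ≤-refl
  ... | inj₂ (p , _ , refl , _ ∷ p≁e) = II-before-minimal-even p noEe (oeCondition⇒noOe ex oe) ee p≁e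

-- An even head x would be at most the minimal even b < n, making the odd n minimal.
II-head-before-odd : Unique (x ∷ n ∷ w) → II.Head (x ∷ n ∷ w) x → Odd n →
                     (Even x → ∃ λ b → Minimal (x ∷ n ∷ w) b × Even b × b < n) → Odd x × n < x
II-head-before-odd {x} u head on even-case with parity x
... | inj₂ ox = ox , ≤∧≢⇒< (proj₂ (II.odd-head⁻ head ox) n-min on) λ { refl → Unique[x∷xs]⇒x∉xs u (here refl) }
  where
  n-min = minimal-after [ x ] u (odd-odd-independent ox on ∷ [])
... | inj₁ ex with b , b-min , eb , b<n ← even-case ex =
  contradiction on
    (noMinimalOdd⇒¬odd even-first (minimal-after [ x ] u (even-below-odd-independent ex on x<n ∷ [])))
  where
  even-first = proj₁ (II.even-head⁻ head ex)
  x<n = ≤-<-trans (proj₂ (II.even-head⁻ head ex) b-min eb) b<n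

II-even-after-odd-run : ∀ α {β} → Unique (x ∷ α ++ a ∷ b ∷ β) → Even x → Even b → b < a →
                        All IsOdd (α ++ [ a ]) → Linked _>_ (α ++ [ a ]) → Minimal (x ∷ α ++ a ∷ b ∷ β) b
II-even-after-odd-run {x} {a} {b} α {β} u ex eb b<a α-odd α-desc rewrite sym (++-assoc α [ a ] (b ∷ β)) =
  minimal-after (x ∷ α ++ [ a ]) u
    (even-even-independent ex eb
     ∷ All.zipWith (λ (oz , a≤z) → odd-above-even-independent (odd oz) eb (<-≤-trans b<a a≤z))
                   (α-odd , descending⇒≥last α α-desc))

II-extend-Oe : Unique (x ∷ w) → II.Head (x ∷ w) x → OeCondition w → OeCondition (x ∷ w)
II-extend-Oe u head oe [] a b (β , refl) (_ , oa , _) = oa ∷ [] , [-]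
II-extend-Oe u head oe (_ ∷ []) a b (β , refl) (b<a , oa , eb)
  with ox , a<x ← II-head-before-odd u head (odd oa)
                    (λ ex → b , II-even-after-odd-run [] u ex (even eb) b<a (oa ∷ []) [-] , even eb , b<a)
  = Odd.isOdd ox ∷ oa ∷ [] , a<x ∷ [-]
II-extend-Oe u head oe (_ ∷ y ∷ α) a b (β , refl) Oe-ab@(b<a , _ , eb)
  with oy ∷ α-odd , desc ← oe (y ∷ α) a b (β , refl) Oe-ab
  with ox , y<x ← II-head-before-odd u head (odd oy)
                    (λ ex → b , II-even-after-odd-run (y ∷ α) u ex (even eb) b<a (oy ∷ α-odd) desc , even eb ,
                            <-≤-trans b<a (All.head (descending⇒≥last (y ∷ α) desc)))
  = Odd.isOdd ox ∷ oy ∷ α-odd , y<x ∷ desc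

II-extend : Unique (x ∷ w) → II.Head (x ∷ w) x → AvoidsII w → AvoidsII (x ∷ w)
II-extend {x} {w} u head (noEe , noeO , nooO , oe) =
  noAdj-∷ Ee-free noEe , noAdj-∷ eO-free noeO , noAdj-∷ oO-free nooO , II-extend-Oe u head oe
  where
  Ee-free : w ≡ y ∷ w′ → ¬ Ee x y
  Ee-free refl (y<x , ex , ey) = <⇒≱ y<x (proj₂ (II.even-head⁻ head (even ex))
    (minimal-after [ x ] u (even-even-independent (even ex) (even ey) ∷ [])) (even ey))
  eO-free : w ≡ y ∷ w′ → ¬ eO x y
  eO-free refl (x<y , ex , oy) = noMinimalOdd⇒¬odd (proj₁ (II.even-head⁻ head (even ex)))
    (minimal-after [ x ] u (even-below-odd-independent (even ex) (odd oy) x<y ∷ [])) (odd oy)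
  oO-free : w ≡ y ∷ w′ → ¬ oO x y
  oO-free refl (x<y , ox , oy) = <⇒≱ x<y (proj₂ (II.odd-head⁻ head (odd ox))
    (minimal-after [ x ] u (odd-odd-independent (odd ox) (odd oy) ∷ [])) (odd oy))

II-criterion : II.NormalFormCriterion AvoidsII
II-criterion = record
  { nil = noAdj-[] , noAdj-[] , noAdj-[] , oeCondition-[] ; tail = avoidsII-tail
  ; head-first = II-head-first ; extend = II-extend }

-- Family III

AvoidsIII : List ℕ → Set
AvoidsIII σ = ¬ ContainsAdj Oo σ × ¬ ContainsAdj eE σ × ¬ Contains-eOd σ

eOd : ℕ → List ℕ → ℕ → Set
eOd a γ b = IsEven a × All IsOdd γ × IsOdd b × a < b

avoidsIII-tail : AvoidsIII (x ∷ w) → AvoidsIII w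
avoidsIII-tail (noOo , noeE , noeOd) = noAdj-tail noOo , noAdj-tail noeE , noSplit-tail {Q = eOd} noeOd

module III = ParityHeads _≤_ ≤-isTotalOrder (flip _≤_) (Flip.isTotalOrder ≤-isTotalOrder)
  NoMinimalOdd noMinimalOdd? noMinimalOdd-resp-∼ noMinimalOdd⇒minimal-even (λ _ → ¬noMinimalOdd⇒minimal-odd)

III-before-minimal-odd : ∀ p → AvoidsIII (p ++ y ∷ q) → Odd y → All (λ z → ¬ Dependent z y) p →
                         All (λ z → Odd z × z ≤ y) p
III-before-minimal-odd []      _      _  _ = []
III-before-minimal-odd {y} {q} (z ∷ p) avoids oy (z≁y ∷ p≁y)
  with rest ← III-before-minimal-odd p (avoidsIII-tail avoids) oy p≁y | parity z
... | inj₂ oz = (oz , z≤y p rest (proj₁ avoids)) ∷ rest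
  where
  z≤y : ∀ p → All (λ z → Odd z × z ≤ y) p → ¬ ContainsAdj Oo (z ∷ p ++ y ∷ q) → z ≤ y
  z≤y []      []               noOo = ≮⇒≥ λ y<z → noAdj-head noOo (y<z , Odd.isOdd oz , Odd.isOdd oy)
  z≤y (c ∷ p) ((oc , c≤y) ∷ _) noOo =
    ≤-trans (≮⇒≥ λ c<z → noAdj-head noOo (c<z , Odd.isOdd oz , Odd.isOdd oc)) c≤y
... | inj₁ ez =
  contradiction (Even.isEven ez , All.map (Odd.isOdd ∘ proj₁) rest , Odd.isOdd oy , independent-even-odd ez oy z≁y)
                             (noSplit-head {Q = eOd} (proj₂ (proj₂ avoids)))

III-before-minimal-even : ∀ p → AvoidsIII (x ∷ p ++ y ∷ q) → Even x → Even y →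
                          All (λ z → ¬ Dependent z y) p → y ≤ x
III-before-minimal-even [] (_ , noeE , _) ex ey [] =
  ≮⇒≥ λ x<y → noAdj-head noeE (x<y , Even.isEven ex , Even.isEven ey)
III-before-minimal-even (z ∷ p) avoids@(_ , noeE , noeOd) ex ey (z≁y ∷ p≁y) with parity z
... | inj₁ ez = ≤-trans (III-before-minimal-even p (avoidsIII-tail avoids) ez ey p≁y)
                        (≮⇒≥ λ x<z → noAdj-head noeE (x<z , Even.isEven ex , Even.isEven ez))
... | inj₂ oz = ≮⇒≥ λ x<y → noSplit-head {Q = eOd} {γ = []} noeOd
                  (Even.isEven ex , [] , Odd.isOdd oz , <-trans x<y (independent-odd-even oz ey z≁y))

III-head-first : Unique (x ∷ w) → AvoidsIII (x ∷ w) → III.Head (x ∷ w) x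
III-head-first {x} u avoids with parity x
... | inj₂ ox = III.odd-head (minimal-head u) (λ none → noMinimalOdd⇒¬odd none (minimal-head u) ox) ox x≤
  where
  x≤ : ∀ {o} → Minimal (x ∷ _) o → Odd o → x ≤ o
  x≤ min oo with minimal-∷ min
  ... | inj₁ refl                  = ≤-refl
  ... | inj₂ (p , _ , refl , x∷p≁o) = proj₂ (All.head (III-before-minimal-odd (x ∷ p) avoids oo x∷p≁o))
... | inj₁ ex = III.even-head (minimal-head u) noOdd ex x≥
  where
  noOdd : NoMinimalOdd (x ∷ _)
  noOdd any with _ , _ , min , oo ← find any with minimal-∷ min
  ... | inj₁ refl                  = even⇒¬odd ex oo
  ... | inj₂ (p , _ , refl , x∷p≁o) =
    even⇒¬odd ex (proj₁ (All.head (III-before-minimal-odd (x ∷ p) avoids oo x∷p≁o)))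
  x≥ : ∀ {e} → Minimal (x ∷ _) e → Even e → e ≤ x
  x≥ min ee with minimal-∷ min
  ... | inj₁ refl                     = ≤-refl
  ... | inj₂ (p , _ , refl , _ ∷ p≁e) = III-before-minimal-even p avoids ex ee p≁e

III-extend : Unique (x ∷ w) → III.Head (x ∷ w) x → AvoidsIII w → AvoidsIII (x ∷ w)
III-extend {x} {w} u head (noOo , noeE , noeOd) =
  noAdj-∷ Oo-free noOo , noAdj-∷ eE-free noeE , noSplit-∷ {Q = eOd} eOd-free noeOd
  where
  Oo-free : w ≡ y ∷ w′ → ¬ Oo x y
  Oo-free refl (y<x , ox , oy) = <⇒≱ y<x (proj₂ (III.odd-head⁻ head (odd ox))
    (minimal-after [ x ] u (odd-odd-independent (odd ox) (odd oy) ∷ [])) (odd oy))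
  eE-free : w ≡ y ∷ w′ → ¬ eE x y
  eE-free refl (x<y , ex , ey) = <⇒≱ x<y (proj₂ (III.even-head⁻ head (even ex))
    (minimal-after [ x ] u (even-even-independent (even ex) (even ey) ∷ [])) (even ey))
  eOd-free : w ≡ γ ++ y ∷ w′ → ¬ eOd x γ y
  eOd-free {γ} refl (ex , γ-odd , oy , x<y) = noMinimalOdd⇒¬odd (proj₁ (III.even-head⁻ head (even ex)))
    (minimal-after (x ∷ γ) u (even-below-odd-independent (even ex) (odd oy) x<y
                              ∷ All.map (λ oz → odd-odd-independent (odd oz) (odd oy)) γ-odd))
    (odd oy)

III-criterion : III.NormalFormCriterion AvoidsIII
III-criterion = record
  { nil = noAdj-[] , noAdj-[] , noSplit-[] {Q = eOd} ; tail = avoidsIII-tail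
  ; head-first = III-head-first ; extend = III-extend }

-- Family IV

-- The side conditions of Oo_d and Ee_d, restated because Defs keeps them local.
OoSide : ℕ → List ℕ → ℕ → Set
OoSide a []       b = a > b
OoSide a (c ∷ cs) b = (a > maxNE c cs) × (maxNE c cs > b)

EeSide : ℕ → List ℕ → ℕ → Set
EeSide a []       b = a > b
EeSide a (c ∷ cs) b = (a > minNE c cs) × (minNE c cs > b)

Ood : ℕ → List ℕ → ℕ → Set
Ood a γ b = IsOdd a × IsOdd b × All IsEven γ × OoSide a γ b

Eed : ℕ → List ℕ → ℕ → Set
Eed a γ b = IsEven a × IsEven b × All IsOdd γ × EeSide a γ b

Contains-Ood⇒ : Contains-Ood σ → ContainsSplit Ood σ
Contains-Ood⇒ (a , []    , b , split , occ) = a , [] , b , split , occ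
Contains-Ood⇒ (a , _ ∷ _ , b , split , occ) = a , _ , b , split , occ

⇒Contains-Ood : ContainsSplit Ood σ → Contains-Ood σ
⇒Contains-Ood (a , []    , b , split , occ) = a , [] , b , split , occ
⇒Contains-Ood (a , _ ∷ _ , b , split , occ) = a , _ , b , split , occ

Contains-Eed⇒ : Contains-Eed σ → ContainsSplit Eed σ
Contains-Eed⇒ (a , []    , b , split , occ) = a , [] , b , split , occ
Contains-Eed⇒ (a , _ ∷ _ , b , split , occ) = a , _ , b , split , occ

⇒Contains-Eed : ContainsSplit Eed σ → Contains-Eed σ
⇒Contains-Eed (a , []    , b , split , occ) = a , [] , b , split , occ
⇒Contains-Eed (a , _ ∷ _ , b , split , occ) = a , _ , b , split , occ

AvoidsIV : List ℕ → Set
AvoidsIV σ = ¬ ContainsAdj eO σ × ¬ ContainsSplit Ood σ × ¬ ContainsSplit Eed σ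

avoidsIV-tail : AvoidsIV (x ∷ w) → AvoidsIV w
avoidsIV-tail (noeO , noOod , noEed) =
  noAdj-tail noeO , noSplit-tail {Q = Ood} noOod , noSplit-tail {Q = Eed} noEed

avoidsIV-suffix : ∀ p → AvoidsIV (p ++ w) → AvoidsIV w
avoidsIV-suffix []      avoids = avoids
avoidsIV-suffix (_ ∷ p) avoids = avoidsIV-suffix p (avoidsIV-tail avoids)

maxNE-< : ∀ c cs → All (_< B) (c ∷ cs) → maxNE c cs < B
maxNE-< c []       (c<B ∷ []) = c<B
maxNE-< c (d ∷ ds) (c<B ∷ rest) = ⊔-lub c<B (maxNE-< d ds rest)

maxNE-≥ : ∀ c cs → All (_≤ maxNE c cs) (c ∷ cs)
maxNE-≥ c []       = ≤-refl ∷ []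
maxNE-≥ c (d ∷ ds) = m≤m⊔n c _ ∷ All.map (λ z≤ → ≤-trans z≤ (m≤n⊔m c _)) (maxNE-≥ d ds)

maxNE-∈ : ∀ c cs → maxNE c cs ∈ c ∷ cs
maxNE-∈ c []       = here refl
maxNE-∈ c (d ∷ ds) with ⊔-sel c (maxNE d ds)
... | inj₁ eq = here eq
... | inj₂ eq = there (subst (_∈ d ∷ ds) (sym eq) (maxNE-∈ d ds))

minNE-≤ : ∀ c cs → All (minNE c cs ≤_) (c ∷ cs)
minNE-≤ c []       = ≤-refl ∷ []
minNE-≤ c (d ∷ ds) = m⊓n≤m c _ ∷ All.map (≤-trans (m⊓n≤n c _)) (minNE-≤ d ds)

minNE-> : ∀ c cs → All (e <_) (c ∷ cs) → e < minNE c cs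
minNE-> c []       (e<c ∷ []) = e<c
minNE-> c (d ∷ ds) (e<c ∷ rest) = ⊓-glb e<c (minNE-> d ds rest)

eO-free⇒below : ¬ eO c b → Even c → Odd b → b < c
eO-free⇒below ¬eO ec ob =
  ≤∧≢⇒< (≮⇒≥ λ c<b → ¬eO (c<b , Even.isEven ec , Odd.isOdd ob)) λ b≡c → even≢odd ec ob (sym b≡c)

maxNE-above-next-odd : ∀ c cs → ¬ ContainsAdj eO (c ∷ cs ++ b ∷ β) → All Even (c ∷ cs) → Odd b → b < maxNE c cs
maxNE-above-next-odd c []       noeO (ec ∷ []) ob =
  eO-free⇒below (noAdj-head noeO) ec ob
maxNE-above-next-odd c (d ∷ ds) noeO (_ ∷ evens) ob =
  <-≤-trans (maxNE-above-next-odd d ds (noAdj-tail noeO) evens ob) (m≤n⊔m c _)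

evenRun-before-odd : ∀ l {q} → Odd o → All (λ z → Even z → z < B) l →
                     ∃₂ λ γ b → ∃ λ β → l ++ o ∷ q ≡ γ ++ b ∷ β × All (λ z → Even z × z < B) γ × Odd b
evenRun-before-odd []      oo _ = [] , _ , _ , refl , [] , oo
evenRun-before-odd (z ∷ l) oo (z-bound ∷ bounds) with parity z
... | inj₂ oz = [] , z , _ , refl , [] , oz
... | inj₁ ez with γ , b , β , eq , run , ob ← evenRun-before-odd l oo bounds =
  z ∷ γ , b , β , cong (z ∷_) eq , (ez , z-bound ez) ∷ run , ob

IV-no-odd-descent : ∀ p → AvoidsIV (c ∷ p ++ o ∷ q) → Odd c → Odd o → B ≤ c → o < B →
                    All (λ z → Even z → z < B) p → ⊥
IV-no-odd-descent [] (_ , noOod , _) oc oo B≤c o<B [] =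
  noSplit-head {Q = Ood} {γ = []} noOod (Odd.isOdd oc , Odd.isOdd oo , [] , <-≤-trans o<B B≤c)
IV-no-odd-descent {c} (z ∷ p) avoids@(noeO , noOod , _) oc oo B≤c o<B (z-bound ∷ bounds) with parity z
... | inj₂ oz = IV-no-odd-descent p (avoidsIV-tail avoids) oz oo (≤-trans B≤c c≤z) o<B bounds
  where
  c≤z = ≮⇒≥ λ z<c → noSplit-head {Q = Ood} {γ = []} noOod (Odd.isOdd oc , Odd.isOdd oz , [] , z<c)
... | inj₁ ez with γ , b , β , eq , run , ob ← evenRun-before-odd p oo bounds =
  noSplit-head {Q = Ood} {γ = z ∷ γ} (subst (λ l → ¬ ContainsSplit Ood (c ∷ z ∷ l)) eq noOod)
    (Odd.isOdd oc , Odd.isOdd ob , All.map (Even.isEven ∘ proj₁) ((ez , z-bound ez) ∷ run) , c>max , max>b)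
  where
  c>max = <-≤-trans (maxNE-< z γ (z-bound ez ∷ All.map proj₂ run)) B≤c
  max>b = maxNE-above-next-odd z γ (subst (λ l → ¬ ContainsAdj eO (z ∷ l)) eq (noAdj-tail noeO))
                                    (ez ∷ All.map proj₁ run) ob

odd-run-below-even : ¬ ContainsAdj eO (c ∷ o ∷ w) → Even c → Odd o → ∀ γ → minNE o γ < c
odd-run-below-even noeO ec oo γ = ≤-<-trans (All.head (minNE-≤ _ γ)) (eO-free⇒below (noAdj-head noeO) ec oo)

-- An odd letter after c starts an odd run ended by an even letter b (possibly e): either c,
-- the run and b form an Ee_d pattern, or b ≥ min(run) > e and the argument restarts at b.
IV-no-even-descent : ∀ fuel p → length p ≤ fuel → AvoidsIV (c ∷ p ++ e ∷ q) → Even c → Even e → e < c →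
                     All (λ z → Odd z → e < z) p → ⊥
IV-no-even-descent _ [] _ (_ , _ , noEed) ec ee e<c [] =
  noSplit-head {Q = Eed} {γ = []} noEed (Even.isEven ec , Even.isEven ee , [] , e<c)
IV-no-even-descent {c} {e} {q} (suc fuel) (z ∷ p) len avoids@(noeO , _ , noEed) ec ee e<c (z-bound ∷ bounds)
  with parity z
... | inj₁ ez = IV-no-even-descent fuel p (≤-pred len) (avoidsIV-tail avoids) ez ee (<-≤-trans e<c c≤z) bounds
  where
  c≤z = ≮⇒≥ λ z<c → noSplit-head {Q = Eed} {γ = []} noEed (Even.isEven ec , Even.isEven ez , [] , z<c)
... | inj₂ oz with First.first (swap ∘ parity) p
...   | inj₂ p-odd =
  noSplit-head {Q = Eed} {γ = z ∷ p} noEed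
    (Even.isEven ec , Even.isEven ee , All.map Odd.isOdd (oz ∷ p-odd) ,
     odd-run-below-even noeO ec oz p ,
     minNE-> z p (z-bound oz ∷ All.zipWith (λ (bound , oy) → bound oy) (bounds , p-odd)))
...   | inj₁ found with toView found
...     | First._++_∷_ {xs = γ} {y = b} γ-odd eb β
  with γ-bounds , _ ∷ β-bounds ← All.++⁻ γ bounds
  with b <? minNE z γ
... | yes b<min =
  noSplit-head {Q = Eed} {γ = z ∷ γ} {w = β ++ e ∷ q}
    (subst (λ l → ¬ ContainsSplit Eed (c ∷ z ∷ l)) reassociate noEed)
    (Even.isEven ec , Even.isEven eb , All.map Odd.isOdd (oz ∷ γ-odd) , odd-run-below-even noeO ec oz γ , b<min)
  where
  reassociate = ++-assoc γ (b ∷ β) (e ∷ q)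
... | no b≮min =
  IV-no-even-descent fuel β β-len
    (avoidsIV-suffix (c ∷ z ∷ γ) (subst (λ l → AvoidsIV (c ∷ z ∷ l)) reassociate avoids))
    eb ee (<-≤-trans e<min (≮⇒≥ b≮min)) β-bounds
  where
  reassociate = ++-assoc γ (b ∷ β) (e ∷ q)
  e<min = minNE-> z γ (z-bound oz ∷ All.zipWith (λ (bound , oy) → bound oy) (γ-bounds , γ-odd))
  β-len = ≤-trans (n≤1+n _) (≤-trans (length-++-≤ʳ (b ∷ β) {γ}) (≤-pred len))

minimal-even-below-odd-head : Odd x → Minimal (x ∷ w) e → Even e → e < x
minimal-even-below-odd-head ox (here refl , _)  ee = contradiction ox (even⇒¬odd ee)
minimal-even-below-odd-head ox (there e∈w , min) ee = independent-odd-even ox ee (min (now e∈w))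

BlockedOnlyByMinimal : List ℕ → ℕ → Set
BlockedOnlyByMinimal w o = ∀ {z} → Precedes w z o → Dependent z o → Minimal w z

below-blocked-odd : ∀ p → BlockedOnlyByMinimal (p ++ o ∷ q) o → Odd o → o < B →
                    (∀ {e} → Minimal (p ++ o ∷ q) e → Even e → e < B) → All (λ z → Even z → z < B) p
below-blocked-odd {o = o} {B = B} p blocked oo o<B minimal-below =
  All.tabulate λ {z} z∈p ez → bound z∈p ez (z <? o)
  where
  bound : ∀ {z} → z ∈ p → Even z → Dec (z < o) → z < B
  bound _   _  (yes z<o) = <-trans z<o o<B
  bound z∈p ez (no z≮o)  = minimal-below (blocked (∈-prefix⇒precedes p z∈p) (inj₂ (oo , ez , o<z))) ez
    where
    o<z = ≤∧≢⇒< (≮⇒≥ z≮o) λ o≡z → even≢odd ez oo (sym o≡z)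

-- When some odd letter is guarded, an odd first letter would start an Oo_d pattern.
GuardedOdd : List ℕ → Set
GuardedOdd w = Any (λ o → Odd o × BlockedOnlyByMinimal w o × Any (λ e → Minimal w e × Even e × o < e) w) w

guardedOdd? : ∀ w → Dec (GuardedOdd w)
guardedOdd? w = any? (λ o → odd? o
                          ×-dec all-preceding? (λ z → Dependent? z o →-dec minimal? w z) w o
                          ×-dec any? (λ e → minimal? w e ×-dec even? e ×-dec o <? e) w) w

guardedOdd-resp-∼ : u ∼ v → GuardedOdd u → GuardedOdd v
guardedOdd-resp-∼ u∼v = Any-resp-↭ (permutation u∼v) ∘ Any.map λ (oo , blocked , above) →
  oo , (λ prec dep → minimal-resp-∼ u∼v (blocked (reflects u∼v dep prec) dep)) ,
  Any-resp-↭ (permutation u∼v) (Any.map (λ (min , ee , o<e) → minimal-resp-∼ u∼v min , ee , o<e) above)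

guarded-after-evens : ∀ p → Unique (p ++ o ∷ q) → All Even p → Odd o → e ∈ p → o < e → GuardedOdd (p ++ o ∷ q)
guarded-after-evens p u p-even oo e∈p o<e =
  lose (∈-++⁺ʳ p (here refl)) (oo , (λ prec _ → evens-minimal (precedes⇒∈-prefix p u prec)) ,
        lose (∈-++⁺ˡ e∈p) (evens-minimal e∈p , All.lookup p-even e∈p , o<e))
  where
  evens-minimal : ∀ {z} → z ∈ p → Minimal (p ++ _ ∷ _) z
  evens-minimal z∈p =
    minimal-within p u z∈p (All.map (λ ey → even-even-independent ey (All.lookup p-even z∈p)) p-even)

noMinimalOdd⇒guarded : Unique w → ¬ All Even w → NoMinimalOdd w → GuardedOdd w
noMinimalOdd⇒guarded {w} u ¬evens none with First.first parity w
... | inj₂ evens = contradiction evens ¬evens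
... | inj₁ found with toView found
... | First._++_∷_ {xs = p} {y = o} p-even oo q with any? (λ z → Dependent? z o) p
...   | yes dep with z , z∈p , z-dep ← find dep = guarded-after-evens p u p-even oo z∈p (o<z z-dep)
  where
  o<z : Dependent z o → o < z
  o<z (inj₁ (oz , _)) = contradiction oz (even⇒¬odd (All.lookup p-even z∈p))
  o<z (inj₂ (_ , _ , o<z)) = o<z
...   | no indep = contradiction oo (noMinimalOdd⇒¬odd none (minimal-after p u (All.¬Any⇒All¬ p indep)))

EvenFirstIV : List ℕ → Set
EvenFirstIV w = All Even w ⊎ GuardedOdd w

evenFirstIV-resp-∼ : u ∼ v → EvenFirstIV u → EvenFirstIV v
evenFirstIV-resp-∼ u∼v (inj₁ evens)   = inj₁ (All-resp-↭ (permutation u∼v) evens)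
evenFirstIV-resp-∼ u∼v (inj₂ guarded) = inj₂ (guardedOdd-resp-∼ u∼v guarded)

evenFirstIV⇒minimal-even : Unique (x ∷ w) → EvenFirstIV (x ∷ w) → ∃ λ e → Minimal (x ∷ w) e × Even e
evenFirstIV⇒minimal-even u (inj₁ (ex ∷ _)) = _ , minimal-head u , ex
evenFirstIV⇒minimal-even u (inj₂ guarded)
  with _ , _ , _ , _ , above ← find guarded with e , _ , min , ee , _ ← find above = e , min , ee

¬evenFirstIV⇒minimal-odd : Unique (x ∷ w) → ¬ EvenFirstIV (x ∷ w) → ∃ λ o → Minimal (x ∷ w) o × Odd o
¬evenFirstIV⇒minimal-odd {x} {w} u odd-first with noMinimalOdd? (x ∷ w)
... | yes none = contradiction (inj₂ (noMinimalOdd⇒guarded u (odd-first ∘ inj₁) none)) odd-first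
... | no some  = ¬noMinimalOdd⇒minimal-odd some

module IV = ParityHeads _≤_ ≤-isTotalOrder _≤_ ≤-isTotalOrder
  EvenFirstIV (λ w → all? even? w ⊎-dec guardedOdd? w) evenFirstIV-resp-∼
  evenFirstIV⇒minimal-even ¬evenFirstIV⇒minimal-odd

last-even-above : ∀ p → ¬ ContainsAdj eO (x ∷ p ++ o ∷ q) → All Even (x ∷ p) → Odd o → ∃ λ e → e ∈ x ∷ p × o < e
last-even-above []      noeO (ex ∷ []) oo = _ , here refl , eO-free⇒below (noAdj-head noeO) ex oo
last-even-above (_ ∷ p) noeO (_ ∷ evens) oo with e , e∈ , o<e ← last-even-above p (noAdj-tail noeO) evens oo =
  e , there e∈ , o<e

IV-head-first : Unique (x ∷ w) → AvoidsIV (x ∷ w) → IV.Head (x ∷ w) x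
IV-head-first {x} {w} u avoids with parity x
... | inj₁ ex = IV.even-head (minimal-head u) even-first ex x≤
  where
  even-first : EvenFirstIV (x ∷ w)
  even-first with First.first parity w
  ... | inj₂ evens = inj₁ (ex ∷ evens)
  ... | inj₁ found with toView found
  ... | First._++_∷_ {xs = p} p-even oo q with e , e∈ , o<e ← last-even-above p (proj₁ avoids) (ex ∷ p-even) oo =
    inj₂ (guarded-after-evens (x ∷ p) u (ex ∷ p-even) oo e∈ o<e)
  x≤ : ∀ {e} → Minimal (x ∷ w) e → Even e → x ≤ e
  x≤ min ee with minimal-∷ min
  ... | inj₁ refl                     = ≤-refl
  ... | inj₂ (p , _ , refl , _ ∷ p≁e) = ≮⇒≥ λ e<x → IV-no-even-descent (length p) p ≤-refl avoids ex ee e<x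
                                           (All.map (λ z≁e oz → independent-odd-even oz ee z≁e) p≁e)
... | inj₂ ox = IV.odd-head (minimal-head u) odd-first ox x≤
  where
  x≤ : ∀ {o} → Minimal (x ∷ w) o → Odd o → x ≤ o
  x≤ min oo with minimal-∷ min
  ... | inj₁ refl                     = ≤-refl
  ... | inj₂ (p , _ , refl , _ ∷ p≁o) = ≮⇒≥ λ o<x → IV-no-odd-descent p avoids ox oo ≤-refl o<x
                                           (All.map (λ z≁o ez → <-trans (independent-even-odd ez oo z≁o) o<x) p≁o)
  odd-first : ¬ EvenFirstIV (x ∷ w)
  odd-first (inj₁ (ex ∷ _)) = even⇒¬odd ex ox
  odd-first (inj₂ guarded)
    with o , o∈ , oo , blocked , above ← find guarded with _ , _ , e-min , ee , o<e ← find above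
    with o<x ← <-trans o<e (minimal-even-below-odd-head ox e-min ee) | o∈
  ... | here refl = <-irrefl refl o<x
  ... | there o∈w with p , q , refl ← ∈-∃++ o∈w = IV-no-odd-descent p avoids ox oo ≤-refl o<x
    (All.tail (below-blocked-odd (x ∷ p) blocked oo o<x (minimal-even-below-odd-head ox)))

Ood-guarded : ∀ {g} γ → Unique (x ∷ g ∷ γ ++ b ∷ β) → Ood x (g ∷ γ) b → GuardedOdd (x ∷ g ∷ γ ++ b ∷ β)
Ood-guarded {x} {b} {β} {g} γ u (ox , ob , run-even , max<x , b<max) =
  lose (∈-++⁺ʳ (x ∷ g ∷ γ) (here refl))
       (odd ob , blocked , lose (there (∈-++⁺ˡ max∈)) (run-minimal max∈ , even (All.lookup run-even max∈) , b<max))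
  where
  max∈ = maxNE-∈ g γ
  run-minimal : ∀ {z} → z ∈ g ∷ γ → Minimal (x ∷ g ∷ γ ++ b ∷ β) z
  run-minimal z∈ = minimal-within (x ∷ g ∷ γ) u (there z∈)
    (odd-above-even-independent (odd ox) ez (≤-<-trans (All.lookup (maxNE-≥ g γ) z∈) max<x)
     ∷ All.map (λ ey → even-even-independent (even ey) ez) run-even)
    where
    ez = even (All.lookup run-even z∈)
  blocked : BlockedOnlyByMinimal (x ∷ g ∷ γ ++ b ∷ β) b
  blocked prec dep with precedes⇒∈-prefix (x ∷ g ∷ γ) u prec
  ... | here refl = contradiction dep (odd-odd-independent (odd ox) (odd ob))
  ... | there z∈  = run-minimal z∈

minimal-even-below-second : x < y → Odd y → Minimal (x ∷ y ∷ w) e → Even e → e < y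
minimal-even-below-second x<y oy (here refl , _)  _  = x<y
minimal-even-below-second x<y oy (there e∈ , min) ee = minimal-even-below-odd-head oy (e∈ , min ∘ later) ee

eO-unguarded : Unique (x ∷ y ∷ w) → AvoidsIV (y ∷ w) → Even x → Odd y → x < y → ¬ GuardedOdd (x ∷ y ∷ w)
eO-unguarded {x} {y} u avoids ex oy x<y guarded
  with o , o∈ , oo , blocked , above ← find guarded with _ , _ , e-min , ee , o<e ← find above
  with o<y ← <-trans o<e (minimal-even-below-second x<y oy e-min ee) | o∈
... | here refl         = even⇒¬odd ex oo
... | there (here refl) = <-irrefl refl o<y
... | there (there o∈w) with p , q , refl ← ∈-∃++ o∈w = IV-no-odd-descent p avoids oy oo ≤-refl o<y
  (All.tail (All.tail (below-blocked-odd (x ∷ y ∷ p) blocked oo o<y (minimal-even-below-second x<y oy))))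

IV-extend : Unique (x ∷ w) → IV.Head (x ∷ w) x → AvoidsIV w → AvoidsIV (x ∷ w)
IV-extend {x} {w} u head avoids@(noeO , noOod , noEed) with parity x
... | inj₁ ex =
  noAdj-∷ eO-free noeO , noSplit-∷ {Q = Ood} (λ _ (ox , _) → even⇒¬odd ex (odd ox)) noOod ,
  noSplit-∷ {Q = Eed} Eed-free noEed
  where
  x≤ = proj₂ (IV.even-head⁻ head ex)
  eO-free : w ≡ y ∷ w′ → ¬ eO x y
  eO-free refl (x<y , _ , oy) with proj₁ (IV.even-head⁻ head ex)
  ... | inj₁ (_ ∷ ey ∷ _) = even⇒¬odd ey (odd oy)
  ... | inj₂ guarded      = eO-unguarded u avoids ex (odd oy) x<y guarded
  Eed-free : w ≡ γ ++ b ∷ w′ → ¬ Eed x γ b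
  Eed-free {[]} refl (_ , eb , _ , b<x) =
    <⇒≱ b<x (x≤ (minimal-after [ x ] u (even-even-independent ex (even eb) ∷ [])) (even eb))
  Eed-free {g ∷ γ} {b} refl (_ , eb , run-odd , min<x , b<min) =
    <-irrefl refl (<-trans (≤-<-trans (x≤ b-min (even eb)) b<min) min<x)
    where
    b-min = minimal-after (x ∷ g ∷ γ) u
      (even-even-independent ex (even eb)
       ∷ All.zipWith (λ (oz , min≤z) → odd-above-even-independent (odd oz) (even eb) (<-≤-trans b<min min≤z))
                     (run-odd , minNE-≤ g γ))
... | inj₂ ox =
  noAdj-∷ (λ _ (_ , ex , _) → even⇒¬odd (even ex) ox) noeO , noSplit-∷ {Q = Ood} Ood-free noOod ,
  noSplit-∷ {Q = Eed} (λ _ (ex , _) → even⇒¬odd (even ex) ox) noEed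
  where
  Ood-free : w ≡ γ ++ b ∷ w′ → ¬ Ood x γ b
  Ood-free {[]} refl (_ , ob , _ , b<x) =
    <⇒≱ b<x (proj₂ (IV.odd-head⁻ head ox) (minimal-after [ x ] u (odd-odd-independent ox (odd ob) ∷ [])) (odd ob))
  Ood-free {_ ∷ γ} refl occ = proj₁ (IV.odd-head⁻ head ox) (inj₂ (Ood-guarded γ u occ))

IV-criterion : IV.NormalFormCriterion AvoidsIV
IV-criterion = record
  { nil = noAdj-[] , noSplit-[] {Q = Ood} , noSplit-[] {Q = Eed} ; tail = avoidsIV-tail
  ; head-first = IV-head-first ; extend = IV-extend }

-- Regions and words

odd-half : IsOdd i → i ≡ suc (2 * (i / 2))
odd-half {i} odd-i = begin
  i                  ≡⟨ m≡m%n+[m/n]*n i 2 ⟩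
  i % 2 + i / 2 * 2  ≡⟨ cong₂ _+_ odd-i (*-comm (i / 2) 2) ⟩
  suc (2 * (i / 2))  ∎
  where open ≡-Reasoning

even-half : IsEven j → j ≡ 2 * (j / 2)
even-half {j} even-j = begin
  j                  ≡⟨ m≡m%n+[m/n]*n j 2 ⟩
  j % 2 + j / 2 * 2  ≡⟨ cong₂ _+_ even-j (*-comm (j / 2) 2) ⟩
  2 * (j / 2)        ∎
  where open ≡-Reasoning

2[1+h]∸1 : ∀ h → 2 * suc h ∸ 1 ≡ suc (2 * h)
2[1+h]∸1 h = cong (_∸ 1) (*-suc 2 h)

ℕ→ℚ : ℕ → ℚ
ℕ→ℚ k = mkℚ (+ k) 0 (coprime-sym (1-coprimeTo k))

ℕ→ℚ-mono-< : a < b → ℕ→ℚ a ℚ.< ℕ→ℚ b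
ℕ→ℚ-mono-< {a} {b} a<b = *<* (subst₂ ℤ._<_ (sym (ℤ.*-identityʳ (+ a))) (sym (ℤ.*-identityʳ (+ b))) (+<+ a<b))

≤∧≢⇒<ℚ : ∀ {p q : ℚ} → p ℚ.≤ q → p ≢ q → p ℚ.< q
≤∧≢⇒<ℚ {p} {q} p≤q p≢q with ℚ.<-cmp p q
... | tri< p<q _ _ = p<q
... | tri≈ _ p≡q _ = contradiction p≡q p≢q
... | tri> _ _ q<p = contradiction (ℚ.<-≤-trans q<p p≤q) (ℚ.<-irrefl refl)

position : List ℕ → ℕ → ℕ
position []      k = 0
position (c ∷ w) k with k ≟ c
... | yes _ = 0
... | no  _ = suc (position w k)

precedes⇒position< : Unique w → Precedes w a b → position w a < position w b
precedes⇒position< {c ∷ w} {a} {b} u (now b∈w) with a ≟ a | b ≟ a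
... | no a≢a | _        = contradiction refl a≢a
... | yes _  | yes refl = contradiction b∈w (Unique[x∷xs]⇒x∉xs u)
... | yes _  | no _     = s≤s z≤n
precedes⇒position< {c ∷ w} {a} {b} u@(_ ∷ u′) (later prec) with a ≟ c | b ≟ c
... | yes refl | _        = contradiction (precedes⇒∈ˡ prec) (Unique[x∷xs]⇒x∉xs u)
... | no _     | yes refl = contradiction (precedes⇒∈ʳ prec) (Unique[x∷xs]⇒x∉xs u)
... | no _     | no _     = s≤s (precedes⇒position< u′ prec)

module Geometry (n : ℕ) where

  private variable
    r r′ : Point n

  letters : List ℕ
  letters = map suc (upTo (2 * n))

  letters-unique : Unique letters
  letters-unique = map⁺ suc-injective (upTo⁺ (2 * n))

  ∈-letters⁺ : 1 ≤ k → k ≤ 2 * n → k ∈ letters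
  ∈-letters⁺ {suc k} _ k≤2n = ∈-map⁺ suc (∈-upTo⁺ k≤2n)

  ∈-letters⁻ : k ∈ letters → 1 ≤ k × k ≤ 2 * n
  ∈-letters⁻ k∈ with _ , k′∈ , refl ← ∈-map⁻ suc k∈ = s≤s z≤n , ∈-upTo⁻ k′∈

  permutation-unique : σ ↭ letters → Unique σ
  permutation-unique σ↭ = Unique-resp-↭ (↭-sym σ↭) letters-unique

  ConstrainedPair : ℕ → ℕ → Set
  ConstrainedPair i j = 1 ≤ i × i < j × j ≤ 2 * n × IsOdd i × IsEven j

  constrained⇒hyperplane : ConstrainedPair i j → HyperplanePair n i j
  constrained⇒hyperplane {i} {j} (_ , i<j , j≤2n , odd-i , even-j) =
    suc h , j / 2 , s≤s z≤n , 1+h≤j/2 , j/2≤n , i≡ , even-half even-j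
    where
    h = i / 2
    i≡ : i ≡ 2 * suc h ∸ 1
    i≡ = trans (odd-half odd-i) (sym (2[1+h]∸1 h))
    1+h≤j/2 : suc h ≤ j / 2
    1+h≤j/2 = *-cancelˡ-≤ 2 (subst₂ _≤_ (trans (cong suc (odd-half odd-i)) (sym (*-suc 2 h))) (even-half even-j) i<j)
    j/2≤n : j / 2 ≤ n
    j/2≤n = *-cancelˡ-≤ 2 (subst (_≤ 2 * n) (even-half even-j) j≤2n)

  hyperplane⇒constrained : HyperplanePair n i j → ConstrainedPair i j
  hyperplane⇒constrained (suc h , J , _ , 1+h≤J , J≤n , refl , refl) rewrite 2[1+h]∸1 h =
    s≤s z≤n , subst (_≤ 2 * J) (*-suc 2 h) (*-mono-≤ (≤-refl {2}) 1+h≤J) , *-mono-≤ (≤-refl {2}) J≤n ,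
    trans (cong (λ t → suc t % 2) (*-comm 2 h)) ([m+kn]%n≡m%n 1 h 2) ,
    trans (cong (_% 2) (*-comm 2 J)) (m*n%n≡0 J 2)

  constrained⇒dependent : ConstrainedPair i j → Dependent i j
  constrained⇒dependent (_ , i<j , _ , odd-i , even-j) = inj₁ (odd odd-i , even even-j , i<j)

  dependent⇒constrained : σ ↭ letters → a ∈ σ → b ∈ σ → Dependent a b → ConstrainedPair a b ⊎ ConstrainedPair b a
  dependent⇒constrained σ↭ a∈ b∈ (inj₁ (oa , eb , a<b)) =
    inj₁ (proj₁ (∈-letters⁻ (∈-resp-↭ σ↭ a∈)) , a<b , proj₂ (∈-letters⁻ (∈-resp-↭ σ↭ b∈)) ,
          Odd.isOdd oa , Even.isEven eb)
  dependent⇒constrained σ↭ a∈ b∈ (inj₂ (ob , ea , b<a)) =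
    inj₂ (proj₁ (∈-letters⁻ (∈-resp-↭ σ↭ b∈)) , b<a , proj₂ (∈-letters⁻ (∈-resp-↭ σ↭ a∈)) ,
          Odd.isOdd ob , Even.isEven ea)

  constrained-precedes-total : σ ↭ letters → ConstrainedPair i j → Precedes σ i j ⊎ Precedes σ j i
  constrained-precedes-total σ↭ (1≤i , i<j , j≤2n , _) =
    precedes-total (permutation-unique σ↭)
      (∈-resp-↭ (↭-sym σ↭) (∈-letters⁺ 1≤i (≤-trans (<⇒≤ i<j) j≤2n)))
      (∈-resp-↭ (↭-sym σ↭) (∈-letters⁺ (≤-trans 1≤i (<⇒≤ i<j)) j≤2n))
      (<⇒≢ i<j)

  before⇒precedes : Before σ a b → Precedes σ a b
  before⇒precedes ([]    , β , refl , b∈β) = now b∈β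
  before⇒precedes (_ ∷ α , β , refl , b∈β) = later (before⇒precedes (α , β , refl , b∈β))

  precedes⇒before : Precedes σ a b → Before σ a b
  precedes⇒before (now {w = w} b∈w) = [] , w , refl , b∈w
  precedes⇒before (later {z = z} prec) with α , β , refl , b∈β ← precedes⇒before prec = z ∷ α , β , refl , b∈β

  Realises : List ℕ → Point n → Set
  Realises σ r = ∀ {i j} → ConstrainedPair i j → Precedes σ i j ⇔ coord n r i ℚ.< coord n r j

  compatible⇒realises : InComplement n r → Compatible n σ r → Realises σ r
  compatible⇒realises {r} r∉ compat (1≤i , i<j , j≤2n , odd-i , even-j)
    with before⇒< , <⇒before ← compat r (r∉ , λ _ _ _ → id , id) _ _ 1≤i i<j j≤2n odd-i even-j =
    mk⇔ (before⇒< ∘ precedes⇒before) (before⇒precedes ∘ <⇒before)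

  realises⇒compatible : Realises σ r → Compatible n σ r
  realises⇒compatible realises x (_ , same-side) i j 1≤i i<j j≤2n odd-i even-j =
    r→x ∘ to (realises pair) ∘ before⇒precedes , precedes⇒before ∘ from (realises pair) ∘ x→r
    where
    pair = (1≤i , i<j , j≤2n , odd-i , even-j)
    x→r = proj₁ (same-side i j (constrained⇒hyperplane pair))
    r→x = proj₂ (same-side i j (constrained⇒hyperplane pair))

  realises-resp-∼ : σ ∼ τ → Realises τ r → Realises σ r
  realises-resp-∼ σ∼τ realises pair =
    mk⇔ (to (realises pair) ∘ preserves σ∼τ dep) (reflects σ∼τ dep ∘ from (realises pair))
    where
    dep = constrained⇒dependent pair

  realisers-∼ : σ ↭ letters → τ ↭ letters → Realises σ r → Realises τ r → σ ∼ τ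
  realisers-∼ σ↭ τ↭ rσ rτ = record
    { permutation = ↭-trans σ↭ (↭-sym τ↭) ; preserves = transfer σ↭ τ↭ rσ rτ ; reflects = transfer τ↭ σ↭ rτ rσ }
    where
    transfer : ∀ {u v} → u ↭ letters → v ↭ letters → Realises u r → Realises v r →
               Dependent a b → Precedes u a b → Precedes v a b
    transfer u↭ v↭ ru rv dep prec with dependent⇒constrained u↭ (precedes⇒∈ˡ prec) (precedes⇒∈ʳ prec) dep
    ... | inj₁ pair = from (rv pair) (to (ru pair) prec)
    ... | inj₂ pair with constrained-precedes-total v↭ pair
    ...   | inj₂ ok   = ok
    ...   | inj₁ back =
      contradiction (from (ru pair) (to (rv pair) back)) (precedes-asym (permutation-unique u↭) prec)

  realisers-sameRegion : Realises σ r → Realises σ r′ → SameRegion n r r′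
  realisers-sameRegion rr rr′ x = move rr rr′ , move rr′ rr
    where
    move : ∀ {r r′} → Realises σ r → Realises σ r′ → InRegionOf n r x → InRegionOf n r′ x
    move rr rr′ (x∉ , same-side) = x∉ , λ p q hp →
      let pair = hyperplane⇒constrained hp ; x→r , r→x = same-side p q hp
      in to (rr′ pair) ∘ from (rr pair) ∘ x→r , r→x ∘ to (rr pair) ∘ from (rr′ pair)

  byCoordinate : Point n → List ℕ
  byCoordinate r = sort letters
    where open Sort (On.decTotalOrder ℚ.≤-decTotalOrder (coord n r))

  byCoordinate-↭ : byCoordinate r ↭ letters
  byCoordinate-↭ {r} = sort-↭ letters
    where open Sort (On.decTotalOrder ℚ.≤-decTotalOrder (coord n r))

  byCoordinate-realises : InComplement n r → Realises (byCoordinate r) r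
  byCoordinate-realises {r} r∉ {i} {j} pair =
    mk⇔ (λ prec → ≤∧≢⇒<ℚ (ascending prec) (r∉ _ _ (constrained⇒hyperplane pair))) increasing⇒precedes
    where
    open Sort (On.decTotalOrder ℚ.≤-decTotalOrder (coord n r))
    ascending : Precedes (byCoordinate r) a b → coord n r a ℚ.≤ coord n r b
    ascending = AllPairs⇒precedes (Linked⇒AllPairs ℚ.≤-trans (sort-↗ letters))
    increasing⇒precedes : coord n r i ℚ.< coord n r j → Precedes (byCoordinate r) i j
    increasing⇒precedes r< with constrained-precedes-total byCoordinate-↭ pair
    ... | inj₁ ok   = ok
    ... | inj₂ back = contradiction (ℚ.<-≤-trans r< (ascending back)) (ℚ.<-irrefl refl)

  positionPoint : List ℕ → Point n
  positionPoint σ f = ℕ→ℚ (position σ (suc (toℕ f)))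

  coord-positionPoint : 1 ≤ k → k ≤ 2 * n → coord n (positionPoint σ) k ≡ ℕ→ℚ (position σ k)
  coord-positionPoint {suc k} {σ} _ 1+k≤2n with k <? suc (2 * n)
  ... | yes k<1+2n = cong (λ t → ℕ→ℚ (position σ (suc t))) (toℕ-fromℕ< k<1+2n)
  ... | no  k≮1+2n = contradiction (≤-trans 1+k≤2n (n≤1+n _)) k≮1+2n

  positionPoint-< : σ ↭ letters → Precedes σ a b → coord n (positionPoint σ) a ℚ.< coord n (positionPoint σ) b
  positionPoint-< {σ} σ↭ prec with 1≤a , a≤2n ← ∈-letters⁻ (∈-resp-↭ σ↭ (precedes⇒∈ˡ prec))
                           with 1≤b , b≤2n ← ∈-letters⁻ (∈-resp-↭ σ↭ (precedes⇒∈ʳ prec)) =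
    subst₂ ℚ._<_ (sym (coord-positionPoint {σ = σ} 1≤a a≤2n)) (sym (coord-positionPoint {σ = σ} 1≤b b≤2n))
           (ℕ→ℚ-mono-< (precedes⇒position< (permutation-unique σ↭) prec))

  positionPoint-inComplement : σ ↭ letters → InComplement n (positionPoint σ)
  positionPoint-inComplement σ↭ p q hp with constrained-precedes-total σ↭ (hyperplane⇒constrained hp)
  ... | inj₁ p-first = ℚ.<⇒≢ (positionPoint-< σ↭ p-first)
  ... | inj₂ q-first = ℚ.<⇒≢ (positionPoint-< σ↭ q-first) ∘ sym

  positionPoint-realises : σ ↭ letters → Realises σ (positionPoint σ)
  positionPoint-realises {σ} σ↭ {i} {j} pair = mk⇔ (positionPoint-< σ↭) increasing⇒precedes
    where
    increasing⇒precedes : coord n (positionPoint σ) i ℚ.< coord n (positionPoint σ) j → Precedes σ i j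
    increasing⇒precedes lt with constrained-precedes-total σ↭ pair
    ... | inj₁ ok   = ok
    ... | inj₂ back = contradiction lt (ℚ.<-asym (positionPoint-< σ↭ back))

  compatible⇒sameRegion : InComplement n r → InComplement n r′ →
                          Compatible n σ r → Compatible n σ r′ → SameRegion n r r′
  compatible⇒sameRegion r∉ r′∉ compat compat′ =
    realisers-sameRegion (compatible⇒realises r∉ compat) (compatible⇒realises r′∉ compat′)

  permutation⇒region : σ ↭ letters → Σ (Point n) λ r → InComplement n r × Compatible n σ r
  permutation⇒region {σ} σ↭ =
    positionPoint σ , positionPoint-inComplement σ↭ , realises⇒compatible (positionPoint-realises σ↭)

headRule : Family → HeadRule
headRule II  = II.rule
headRule III = III.rule
headRule IV  = IV.rule

Avoids : Family → List ℕ → Set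
Avoids II  = AvoidsII
Avoids III = AvoidsIII
Avoids IV  = AvoidsIV

criterion : ∀ F → NormalForms.NormalFormCriterion (headRule F) (Avoids F)
criterion II  = II-criterion
criterion III = III-criterion
criterion IV  = IV-criterion

𝔊⇒avoids : ∀ F → 𝔊 F n σ → IsPermutation n σ × Avoids F σ
𝔊⇒avoids II  g = g
𝔊⇒avoids III g = g
𝔊⇒avoids IV  (perm , noeO , noOod , noEed) = perm , noeO , noOod ∘′ ⇒Contains-Ood , noEed ∘′ ⇒Contains-Eed

avoids⇒𝔊 : ∀ F → IsPermutation n σ → Avoids F σ → 𝔊 F n σ
avoids⇒𝔊 II  perm avoids = perm , avoids
avoids⇒𝔊 III perm avoids = perm , avoids
avoids⇒𝔊 IV  perm (noeO , noOod , noEed) = perm , noeO , noOod ∘′ Contains-Ood⇒ , noEed ∘′ Contains-Eed⇒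

module Correspondence (n : ℕ) (F : Family) where
  open Geometry n
  open NormalForms (headRule F)

  normalForm⇒𝔊 : σ ↭ letters → NormalForm σ → 𝔊 F n σ
  normalForm⇒𝔊 σ↭ nσ = avoids⇒𝔊 F σ↭ (normalForm⇒criterion (criterion F) (permutation-unique σ↭) nσ)

  𝔊⇒normalForm : 𝔊 F n σ → NormalForm σ
  𝔊⇒normalForm g with σ↭ , avoids ← 𝔊⇒avoids F g =
    criterion⇒normalForm (criterion F) (permutation-unique σ↭) avoids

  unique-compatible : (r : Point n) → InComplement n r →
    Σ (List ℕ) λ σ → 𝔊 F n σ × Compatible n σ r × ((τ : List ℕ) → 𝔊 F n τ → Compatible n τ r → τ ≡ σ)
  unique-compatible r r∉ with σ , nσ , σ∼π ← normalise (permutation-unique (byCoordinate-↭ {r})) =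
    σ , normalForm⇒𝔊 σ↭ nσ , realises⇒compatible σ-realises , unique
    where
    σ↭ = ↭-trans (permutation σ∼π) byCoordinate-↭
    σ-realises = realises-resp-∼ σ∼π (byCoordinate-realises r∉)
    unique : (τ : List ℕ) → 𝔊 F n τ → Compatible n τ r → τ ≡ σ
    unique τ g compat with τ↭ , _ ← 𝔊⇒avoids F g =
      normalForm-unique (permutation-unique τ↭) (permutation-unique σ↭)
        (realisers-∼ τ↭ σ↭ (compatible⇒realises r∉ compat) σ-realises) (𝔊⇒normalForm g) nσ

theorem3p6 : (n : ℕ) → 1 ≤ n → (F : Family) →
    -- every region (represented by a base point r of the complement) has exactly one compatible σ ∈ X
    ((r : Point n) → InComplement n r →
      Σ (List ℕ) λ σ → 𝔊 F n σ × Compatible n σ r ×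
        ((τ : List ℕ) → 𝔊 F n τ → Compatible n τ r → τ ≡ σ)) ×
    -- the induced map R(K_2n) → X is injective
    ((r r' : Point n) → InComplement n r → InComplement n r' →
      (σ : List ℕ) → 𝔊 F n σ → Compatible n σ r → Compatible n σ r' → SameRegion n r r') ×
    -- and surjective
    ((σ : List ℕ) → 𝔊 F n σ →
      Σ (Point n) λ r → InComplement n r × Compatible n σ r)
-- The argument does not need 1 ≤ n: it covers n = 0 as well.
theorem3p6 n _ F =
  unique-compatible ,
  (λ r r′ r∉ r′∉ σ _ → compatible⇒sameRegion r∉ r′∉) ,
  (λ σ g → permutation⇒region (proj₁ (𝔊⇒avoids F g)))
  where
  open Geometry n
  open Correspondence n F
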